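{- Let $d \geq 1$ be an even integer and $c \geq 1$ an integer with $\gcd(d,c) = 1$. Then $$2\,s(d,c) + s(2c,d) = \frac{d^2 + c^2 + 1}{6cd} - \frac{1}{2} - \frac{1}{4} S_4(c, d/2).$$
   Context: For integers $h$ and $k \geq 1$, $s(h,k) = \sum_{r=1}^{k-1} ((r/k))((hr/k))$, where $((x)) = x - \lfloor x \rfloor - \frac12$ for $x \notin \mathbf{Z}$ and $((x)) = 0$ for $x \in \mathbf{Z}$. For coprime integers $h,k$ with $k \geq 1$ and $h$ odd, $S_4(h,k) = \sum_{j=1}^{k-1} (-1)^{\lfloor jh/k \rfloor}$ (here $c$ is odd, being coprime to the even $d$). -}

module Defs where

open import Data.Nat as ℕ using (ℕ; zero; suc)
open import Data.Integer as ℤ using (ℤ; +_)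
open import Data.Rational using (ℚ; _/_; _+_; _-_; _*_; ½; 0ℚ; 1ℚ; floor; _≟_; -_)
open import Data.Bool using (if_then_else_)
open import Relation.Nullary using (does)

-- total division a / n of an integer by a natural, with the (never used
-- under the hypotheses) convention a / 0 = 0
frac : ℤ → ℕ → ℚ
frac a zero    = 0ℚ
frac a (suc n) = a / suc n

toℚ : ℤ → ℚ
toℚ z = z / 1

saw : ℚ → ℚ
saw x = if does (x ≟ toℚ (floor x)) then 0ℚ else (x - toℚ (floor x)) - ½

-- sumQ n f = f 1 + f 2 + ... + f (n - 1)   (empty for n ≤ 1)
sumQ : ℕ → (ℕ → ℚ) → ℚ
sumQ zero    f = 0ℚ
sumQ (suc zero) f = 0ℚ
sumQ (suc (suc n)) f = sumQ (suc n) f + f (suc n)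

sumZ : ℕ → (ℕ → ℤ) → ℤ
sumZ zero    f = + 0
sumZ (suc zero) f = + 0
sumZ (suc (suc n)) f = sumZ (suc n) f ℤ.+ f (suc n)

s : ℤ → ℕ → ℚ
s h k = sumQ k (λ r → saw (frac (+ r) k) * saw (frac (h ℤ.* + r) k))

negOnePow : ℤ → ℤ
negOnePow n = if does (ℤ.∣ n ∣ ℕ.% 2 ℕ.≟ 0) then + 1 else ℤ.- (+ 1)

S₄ : ℤ → ℕ → ℤ
S₄ h k = sumZ k (λ j → negOnePow (floor (frac (+ j ℤ.* h) k)))

module Submission where

-- With sawℤ a k = 2k·((a/k)) one has 4k²·s(h,k) = Σ_r sawℤ(r)·sawℤ(hr), so everything becomes an integer identity.
-- Reciprocity s(h,k) + s(k,h) = (h² + k² + 1)/(12hk) - 1/4 follows from Σ_r (hr mod k)² = Σ_r r² and the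
-- lattice-point formula Σ_r ⌊hr/k⌋² = Σ_s (2s - 1)·#{r : ks < hr}.  Write d = 2m and c = 2H + 1.
-- Then s(2c, 2m) = s(c, m), and re-indexing by r ↦ 2r mod c gives s(m, c) = 2 s(2m, c) + X/(2c) with
-- X = Σ_{r ≤ H} sawℤ(dr).  Counting the lattice points below the line d y = c x gives 2X = c - m + c·S₄(c, m),
-- and reciprocity for (m, c) concludes.

module IntegerValued where

  open import Defs
  open import Data.Nat as ℕ using (ℕ; zero; suc; z≤n; s≤s; _≤?_; NonZero)
  import Data.Nat.Properties as ℕP
  open import Data.Nat.DivMod
  open import Data.Nat.Divisibility using (_∣_; divides; ∣⇒≤; ∣-trans; m∣m*n; n∣m*n; m%n≡0⇒n∣m)
  open import Data.Nat.Coprimality using (Coprime; coprime-Bézout; coprime-divisor)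
  import Data.Nat.Coprimality as Coprime
  open import Data.Nat.GCD using (module Bézout)
  import Data.Nat.Tactic.RingSolver as ℕ-Solver
  open import Data.Fin as Fin using (Fin; toℕ)
  import Data.Fin.Properties as FinP
  open import Data.Fin.Permutation using (permutation)
  open import Data.Integer as ℤ using (ℤ; +_; _+_; _*_; -_; _-_)
  import Data.Integer.Properties as ℤP
  open import Data.Integer.Tactic.RingSolver using (solve-∀; solve)
  open import Algebra.Properties.AbelianGroup ℤP.+-0-abelianGroup using (//-rightDividesˡ) renaming (∙-cancelˡ to +-cancelˡ)
  open import Algebra.Properties.CommutativeMonoid.Sum ℤP.+-0-commutativeMonoid using (sum; sum-permute; sum-cong-≗)
  open import Data.List using (_∷_; [])
  open import Data.Product using (∃; _,_)
  open import Data.Empty using (⊥-elim)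
  open import Relation.Binary.PropositionalEquality
  open import Relation.Nullary using (Dec; yes; no; ¬_)

  sumZ-cong : ∀ n {f g : ℕ → ℤ} → (∀ r → r ℕ.< n → f (suc r) ≡ g (suc r)) →
              sumZ (suc n) f ≡ sumZ (suc n) g
  sumZ-cong zero    eq = refl
  sumZ-cong (suc n) eq = cong₂ _+_ (sumZ-cong n (λ r r<n → eq r (ℕP.m<n⇒m<1+n r<n))) (eq n (ℕP.n<1+n n))

  sumZ-+ : ∀ n (f g : ℕ → ℤ) → sumZ (suc n) (λ r → f r + g r) ≡ sumZ (suc n) f + sumZ (suc n) g
  sumZ-+ zero    f g = refl
  sumZ-+ (suc n) f g rewrite sumZ-+ n f g = interchange (sumZ (suc n) f) (sumZ (suc n) g) (f (suc n)) (g (suc n))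
    where
    interchange : ∀ a b x y → a + b + (x + y) ≡ a + x + (b + y)
    interchange = solve-∀

  sumZ-* : ∀ n a (f : ℕ → ℤ) → sumZ (suc n) (λ r → a * f r) ≡ a * sumZ (suc n) f
  sumZ-* zero    a f = sym (ℤP.*-zeroʳ a)
  sumZ-* (suc n) a f rewrite sumZ-* n a f = sym (ℤP.*-distribˡ-+ a (sumZ (suc n) f) (f (suc n)))

  sumZ-const : ∀ n a → sumZ (suc n) (λ _ → a) ≡ + n * a
  sumZ-const zero    a = sym (ℤP.*-zeroˡ a)
  sumZ-const (suc n) a rewrite sumZ-const n a = step (+ n) a
    where
    step : ∀ x a → x * a + a ≡ (+ 1 + x) * a
    step = solve-∀

  sumZ-neg : ∀ n (f : ℕ → ℤ) → sumZ (suc n) (λ r → - f r) ≡ - sumZ (suc n) f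
  sumZ-neg zero    f = refl
  sumZ-neg (suc n) f rewrite sumZ-neg n f = sym (ℤP.neg-distrib-+ (sumZ (suc n) f) (f (suc n)))

  sumZ-lin : ∀ n a (f g : ℕ → ℤ) →
             sumZ (suc n) (λ r → a * f r + g r) ≡ a * sumZ (suc n) f + sumZ (suc n) g
  sumZ-lin n a f g = trans (sumZ-+ n (λ r → a * f r) g) (cong (_+ sumZ (suc n) g) (sumZ-* n a f))

  sumZ-lin₂ : ∀ n a b (f g : ℕ → ℤ) →
              sumZ (suc n) (λ r → a * f r + b * g r) ≡ a * sumZ (suc n) f + b * sumZ (suc n) g
  sumZ-lin₂ n a b f g = trans (sumZ-lin n a f (λ r → b * g r)) (cong (λ z → a * sumZ (suc n) f + z) (sumZ-* n b g))

  sumZ-sub₂ : ∀ n a b (f g : ℕ → ℤ) →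
              sumZ (suc n) (λ r → a * f r - b * g r) ≡ a * sumZ (suc n) f - b * sumZ (suc n) g
  sumZ-sub₂ n a b f g = begin
    sumZ (suc n) (λ r → a * f r - b * g r)                  ≡⟨ sumZ-lin n a f (λ r → - (b * g r)) ⟩
    a * sumZ (suc n) f + sumZ (suc n) (λ r → - (b * g r))   ≡⟨ cong (λ z → a * sumZ (suc n) f + z) (sumZ-neg n (λ r → b * g r)) ⟩
    a * sumZ (suc n) f - sumZ (suc n) (λ r → b * g r)       ≡⟨ cong (λ z → a * sumZ (suc n) f - z) (sumZ-* n b g) ⟩
    a * sumZ (suc n) f - b * sumZ (suc n) g                 ∎
    where open ≡-Reasoning

  sumZ-lin₃ : ∀ n a b c (f g h : ℕ → ℤ) →
              sumZ (suc n) (λ r → a * f r + (b * g r + c * h r))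
              ≡ a * sumZ (suc n) f + (b * sumZ (suc n) g + c * sumZ (suc n) h)
  sumZ-lin₃ n a b c f g h =
    trans (sumZ-lin n a f _) (cong (λ z → a * sumZ (suc n) f + z) (sumZ-lin₂ n b c g h))

  sumZ-lin₂-const : ∀ n a b K (f g : ℕ → ℤ) →
                    sumZ (suc n) (λ r → a * f r + (b * g r + K))
                    ≡ a * sumZ (suc n) f + (b * sumZ (suc n) g + + n * K)
  sumZ-lin₂-const n a b K f g
    rewrite sumZ-lin n a f (λ r → b * g r + K) | sumZ-lin n b g (λ _ → K) | sumZ-const n K = refl

  sumZ-lin₃-const : ∀ n a b c K (f g h : ℕ → ℤ) →
                    sumZ (suc n) (λ r → a * f r + (b * g r + (c * h r + K)))
                    ≡ a * sumZ (suc n) f + (b * sumZ (suc n) g + (c * sumZ (suc n) h + + n * K))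
  sumZ-lin₃-const n a b c K f g h
    rewrite sumZ-lin n a f (λ r → b * g r + (c * h r + K)) | sumZ-lin₂-const n b c K g h = refl

  sumZ-lin₄-const : ∀ n a b c e K (f g h i : ℕ → ℤ) →
                    sumZ (suc n) (λ r → a * f r + (b * g r + (c * h r + (e * i r + K))))
                    ≡ a * sumZ (suc n) f + (b * sumZ (suc n) g + (c * sumZ (suc n) h + (e * sumZ (suc n) i + + n * K)))
  sumZ-lin₄-const n a b c e K f g h i
    rewrite sumZ-lin n a f (λ r → b * g r + (c * h r + (e * i r + K))) | sumZ-lin₃-const n b c e K g h i = refl

  sumZ-swap : ∀ n k (f : ℕ → ℕ → ℤ) →
              sumZ (suc n) (λ r → sumZ (suc k) (f r)) ≡ sumZ (suc k) (λ s → sumZ (suc n) (λ r → f r s))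
  sumZ-swap zero    k f = sym (trans (sumZ-cong k (λ _ _ → refl)) (trans (sumZ-const k (+ 0)) (ℤP.*-zeroʳ (+ k))))
  sumZ-swap (suc n) k f rewrite sumZ-swap n k f = sym (sumZ-+ k (λ s → sumZ (suc n) (λ r → f r s)) (f (suc n)))

  sumZ-split : ∀ a b (f : ℕ → ℤ) → sumZ (suc (a ℕ.+ b)) f ≡ sumZ (suc a) f + sumZ (suc b) (λ t → f (a ℕ.+ t))
  sumZ-split a zero    f rewrite ℕP.+-identityʳ a = sym (ℤP.+-identityʳ _)
  sumZ-split a (suc b) f rewrite ℕP.+-suc a b | sumZ-split a b f = ℤP.+-assoc (sumZ (suc a) f) _ _

  sumZ-unfoldˡ : ∀ n (g : ℕ → ℤ) → sumZ (suc (suc n)) g ≡ g 1 + sumZ (suc n) (λ r → g (suc r))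
  sumZ-unfoldˡ zero    g = ℤP.+-comm (+ 0) (g 1)
  sumZ-unfoldˡ (suc n) g rewrite sumZ-unfoldˡ n g = ℤP.+-assoc (g 1) (sumZ (suc n) (λ r → g (suc r))) (g (suc (suc n)))

  powerSum₁ powerSum₂ : ℕ → ℤ
  powerSum₁ k = sumZ k (λ r → + r)
  powerSum₂ k = sumZ k (λ r → + r * + r)

  2*powerSum₁ : ∀ n → + 2 * powerSum₁ (suc n) ≡ + n * (+ n + + 1)
  2*powerSum₁ zero    = refl
  2*powerSum₁ (suc n) = begin
    + 2 * (powerSum₁ (suc n) + + suc n)      ≡⟨ ℤP.*-distribˡ-+ (+ 2) (powerSum₁ (suc n)) (+ suc n) ⟩
    + 2 * powerSum₁ (suc n) + + 2 * + suc n  ≡⟨ cong (_+ + 2 * + suc n) (2*powerSum₁ n) ⟩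
    + n * (+ n + + 1) + + 2 * (+ 1 + + n)    ≡⟨ step (+ n) ⟩
    (+ 1 + + n) * (+ 1 + + n + + 1)           ∎
    where
    open ≡-Reasoning
    step : ∀ x → x * (x + + 1) + + 2 * (+ 1 + x) ≡ (+ 1 + x) * (+ 1 + x + + 1)
    step = solve-∀

  6*powerSum₂ : ∀ n → + 6 * powerSum₂ (suc n) ≡ + n * (+ n + + 1) * (+ 2 * + n + + 1)
  6*powerSum₂ zero    = refl
  6*powerSum₂ (suc n) = begin
    + 6 * (powerSum₂ (suc n) + + suc n * + suc n)
      ≡⟨ ℤP.*-distribˡ-+ (+ 6) (powerSum₂ (suc n)) (+ suc n * + suc n) ⟩
    + 6 * powerSum₂ (suc n) + + 6 * (+ suc n * + suc n)
      ≡⟨ cong (_+ + 6 * (+ suc n * + suc n)) (6*powerSum₂ n) ⟩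
    + n * (+ n + + 1) * (+ 2 * + n + + 1) + + 6 * ((+ 1 + + n) * (+ 1 + + n))
      ≡⟨ step (+ n) ⟩
    (+ 1 + + n) * (+ 1 + + n + + 1) * (+ 2 * (+ 1 + + n) + + 1) ∎
    where
    open ≡-Reasoning
    step : ∀ x → x * (x + + 1) * (+ 2 * x + + 1) + + 6 * ((+ 1 + x) * (+ 1 + x))
                 ≡ (+ 1 + x) * (+ 1 + x + + 1) * (+ 2 * (+ 1 + x) + + 1)
    step = solve-∀

  sum-odd : ∀ n → sumZ (suc n) (λ s → + 2 * + s - + 1) ≡ + n * + n
  sum-odd zero    = refl
  sum-odd (suc n) rewrite sum-odd n = step (+ n)
    where
    step : ∀ x → x * x + (+ 2 * (+ 1 + x) - + 1) ≡ (+ 1 + x) * (+ 1 + x)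
    step = solve-∀

  iverson : ∀ {p} {P : Set p} → Dec P → ℤ → ℤ
  iverson (yes _) x = x
  iverson (no _)  x = + 0

  iverson-complement : ∀ a b y → a ≢ b → iverson (a ≤? b) y ≡ y + - iverson (b ≤? a) y
  iverson-complement a b y a≢b with a ≤? b | b ≤? a
  ... | yes a≤b | yes b≤a = ⊥-elim (a≢b (ℕP.≤-antisym a≤b b≤a))
  ... | yes _   | no _    = sym (ℤP.+-identityʳ y)
  ... | no _    | yes _   = sym (ℤP.+-inverseʳ y)
  ... | no a≰b  | no b≰a  = ⊥-elim (a≰b (ℕP.≰⇒≥ b≰a))

  ≤/⇒*≤ : ∀ b x s .{{_ : NonZero b}} → s ℕ.≤ x / b → b ℕ.* s ℕ.≤ x
  ≤/⇒*≤ b x s s≤x/b = ℕP.≤-trans (ℕP.*-monoʳ-≤ b s≤x/b) (subst (ℕ._≤ x) (ℕP.*-comm (x / b) b) (m/n*n≤m x b))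

  *≤⇒≤/ : ∀ b x s .{{_ : NonZero b}} → b ℕ.* s ℕ.≤ x → s ℕ.≤ x / b
  *≤⇒≤/ b x s bs≤x = subst (ℕ._≤ x / b) (trans (cong (_/ b) (ℕP.*-comm b s)) (m*n/n≡m s b)) (/-monoˡ-≤ b bs≤x)

  module _ (b x : ℕ) .{{_ : NonZero b}} (g : ℕ → ℤ) where

    private
      below : ℕ → ℤ
      below s = iverson (b ℕ.* s ≤? x) (g s)

      sum-below-≤ : ∀ M → M ℕ.≤ x / b → sumZ (suc M) below ≡ sumZ (suc M) g
      sum-below-≤ M M≤x/b = sumZ-cong M included
        where
        included : ∀ r → r ℕ.< M → below (suc r) ≡ g (suc r)
        included r r<M with b ℕ.* suc r ≤? x
        ... | yes _ = refl
        ... | no bs≰x = ⊥-elim (bs≰x (≤/⇒*≤ b x (suc r) (ℕP.≤-trans r<M M≤x/b)))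

      sum-below-+ : ∀ k → sumZ (suc (x / b ℕ.+ k)) below ≡ sumZ (suc (x / b)) g
      sum-below-+ zero rewrite ℕP.+-identityʳ (x / b) = sum-below-≤ (x / b) ℕP.≤-refl
      sum-below-+ (suc k) rewrite ℕP.+-suc (x / b) k =
        trans (cong (λ z → sumZ (suc (x / b ℕ.+ k)) below + z) excluded)
              (trans (ℤP.+-identityʳ _) (sum-below-+ k))
        where
        excluded : below (suc (x / b ℕ.+ k)) ≡ + 0
        excluded with b ℕ.* suc (x / b ℕ.+ k) ≤? x
        ... | no _ = refl
        ... | yes bs≤x = ⊥-elim (ℕP.<⇒≱ (s≤s (ℕP.m≤m+n (x / b) k)) (*≤⇒≤/ b x _ bs≤x))

    sum-iverson-≤ : ∀ M → x / b ℕ.≤ M →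
                    sumZ (suc M) (λ s → iverson (b ℕ.* s ≤? x) (g s)) ≡ sumZ (suc (x / b)) g
    sum-iverson-≤ M x/b≤M =
      subst (λ z → sumZ (suc z) below ≡ sumZ (suc (x / b)) g) (ℕP.m+[n∸m]≡n x/b≤M) (sum-below-+ (M ℕ.∸ x / b))

  -- Σ g(s) over the lattice points 1 ≤ r ≤ N, 1 ≤ s ≤ M with k s ≤ h r, by columns and by rows
  module _ (k h : ℕ) .{{_ : NonZero k}} .{{_ : NonZero h}} (N M : ℕ) (g : ℕ → ℤ)
    (column-bound : ∀ r → r ℕ.< N → h ℕ.* suc r / k ℕ.≤ M)
    (row-bound : ∀ s → s ℕ.< M → k ℕ.* suc s / h ℕ.≤ N)
    (off-line : ∀ r s → r ℕ.< N → s ℕ.< M → k ℕ.* suc s ≢ h ℕ.* suc r) where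

    lattice-sum : sumZ (suc N) (λ r → sumZ (suc (h ℕ.* r / k)) g)
                ≡ sumZ (suc M) (λ s → g s * (+ N - + (k ℕ.* s / h)))
    lattice-sum = begin
      sumZ (suc N) (λ r → sumZ (suc (h ℕ.* r / k)) g)
        ≡⟨ sym (sumZ-cong N (λ r r<N → sum-iverson-≤ k (h ℕ.* suc r) g M (column-bound r r<N))) ⟩
      sumZ (suc N) (λ r → sumZ (suc M) (λ s → iverson (k ℕ.* s ≤? h ℕ.* r) (g s)))
        ≡⟨ sumZ-swap N M _ ⟩
      sumZ (suc M) (λ s → sumZ (suc N) (λ r → iverson (k ℕ.* s ≤? h ℕ.* r) (g s)))
        ≡⟨ sumZ-cong M row ⟩
      sumZ (suc M) (λ s → g s * (+ N - + (k ℕ.* s / h))) ∎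
      where
      open ≡-Reasoning
      row : ∀ s → s ℕ.< M → sumZ (suc N) (λ r → iverson (k ℕ.* suc s ≤? h ℕ.* r) (g (suc s)))
                            ≡ g (suc s) * (+ N - + (k ℕ.* suc s / h))
      row s s<M = begin
        sumZ (suc N) (λ r → iverson (k ℕ.* suc s ≤? h ℕ.* r) y)
          ≡⟨ sumZ-cong N (λ r r<N → iverson-complement (k ℕ.* suc s) (h ℕ.* suc r) y (off-line r s r<N s<M)) ⟩
        sumZ (suc N) (λ r → y + - iverson (h ℕ.* r ≤? k ℕ.* suc s) y)
          ≡⟨ sumZ-+ N (λ _ → y) _ ⟩
        sumZ (suc N) (λ _ → y) + sumZ (suc N) (λ r → - iverson (h ℕ.* r ≤? k ℕ.* suc s) y)
          ≡⟨ cong₂ _+_ (sumZ-const N y) (sumZ-neg N _) ⟩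
        + N * y + - sumZ (suc N) (λ r → iverson (h ℕ.* r ≤? k ℕ.* suc s) y)
          ≡⟨ cong (λ z → + N * y + - z) (sum-iverson-≤ h (k ℕ.* suc s) (λ _ → y) N (row-bound s s<M)) ⟩
        + N * y + - sumZ (suc (k ℕ.* suc s / h)) (λ _ → y)
          ≡⟨ cong (λ z → + N * y + - z) (sumZ-const (k ℕ.* suc s / h) y) ⟩
        + N * y + - (+ (k ℕ.* suc s / h) * y)
          ≡⟨ factor (+ N) y (+ (k ℕ.* suc s / h)) ⟩
        y * (+ N - + (k ℕ.* suc s / h)) ∎
        where
        y = g (suc s)
        factor : ∀ n y q → n * y + - (q * y) ≡ y * (n - q)
        factor = solve-∀

  *-%-absorbʳ : ∀ a b k .{{_ : NonZero k}} → (a ℕ.* (b % k)) % k ≡ (a ℕ.* b) % k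
  *-%-absorbʳ a b k = begin
    (a ℕ.* (b % k)) % k              ≡⟨ %-distribˡ-* a (b % k) k ⟩
    ((a % k) ℕ.* (b % k % k)) % k    ≡⟨ cong (λ z → ((a % k) ℕ.* z) % k) (m%n%n≡m%n b k) ⟩
    ((a % k) ℕ.* (b % k)) % k        ≡⟨ sym (%-distribˡ-* a b k) ⟩
    (a ℕ.* b) % k                    ∎
    where open ≡-Reasoning

  mod-inverse : ∀ h k' → Coprime h (suc k') → ∃ λ h' → (h' ℕ.* h) % suc k' ≡ 1 % suc k'
  mod-inverse h k' cop with coprime-Bézout cop
  ... | Bézout.+- x y eq = x , (begin
    (x ℕ.* h) % suc k'              ≡⟨ cong (_% suc k') (sym eq) ⟩
    (1 ℕ.+ y ℕ.* suc k') % suc k'   ≡⟨ [m+kn]%n≡m%n 1 y (suc k') ⟩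
    1 % suc k'                      ∎)
    where open ≡-Reasoning
  -- from x h + 1 = y k we get (k - 1) x h ≡ 1 modulo k
  ... | Bézout.-+ x y eq = k' ℕ.* x , (begin
    (k' ℕ.* x ℕ.* h) % suc k'                 ≡⟨ sym ([m+n]%n≡m%n (k' ℕ.* x ℕ.* h) (suc k')) ⟩
    (k' ℕ.* x ℕ.* h ℕ.+ suc k') % suc k'      ≡⟨ cong (_% suc k') shifted ⟩
    (1 ℕ.+ (k' ℕ.* y) ℕ.* suc k') % suc k'    ≡⟨ [m+kn]%n≡m%n 1 (k' ℕ.* y) (suc k') ⟩
    1 % suc k'                                ∎)
    where
    open ≡-Reasoning
    expand : ∀ k' x h → k' ℕ.* x ℕ.* h ℕ.+ suc k' ≡ suc (k' ℕ.* (1 ℕ.+ x ℕ.* h))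
    expand = ℕ-Solver.solve-∀
    regroup : ∀ k' y → k' ℕ.* (y ℕ.* suc k') ≡ k' ℕ.* y ℕ.* suc k'
    regroup = ℕ-Solver.solve-∀
    shifted : k' ℕ.* x ℕ.* h ℕ.+ suc k' ≡ 1 ℕ.+ (k' ℕ.* y) ℕ.* suc k'
    shifted = trans (expand k' x h) (cong suc (trans (cong (k' ℕ.*_) eq) (regroup k' y)))

  sum-toℕ : ∀ n (g : ℕ → ℤ) → sum {suc n} (λ i → g (toℕ i)) ≡ g 0 + sumZ (suc n) g
  sum-toℕ zero    g = refl
  sum-toℕ (suc n) g = cong (λ z → g 0 + z) (trans (sum-toℕ n (λ r → g (suc r))) (sym (sumZ-unfoldˡ n g)))

  module _ (k' : ℕ) where

    private
      k = suc k'

    *-%-cancel : ∀ a b i → (a ℕ.* b) % k ≡ 1 % k → i ℕ.< k → (a ℕ.* ((b ℕ.* i) % k)) % k ≡ i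
    *-%-cancel a b i ab≡1 i<k = begin
      (a ℕ.* ((b ℕ.* i) % k)) % k        ≡⟨ *-%-absorbʳ a (b ℕ.* i) k ⟩
      (a ℕ.* (b ℕ.* i)) % k              ≡⟨ cong (_% k) (sym (ℕP.*-assoc a b i)) ⟩
      (a ℕ.* b ℕ.* i) % k                ≡⟨ %-distribˡ-* (a ℕ.* b) i k ⟩
      ((a ℕ.* b % k) ℕ.* (i % k)) % k    ≡⟨ cong (λ z → (z ℕ.* (i % k)) % k) ab≡1 ⟩
      ((1 % k) ℕ.* (i % k)) % k          ≡⟨ sym (%-distribˡ-* 1 i k) ⟩
      (1 ℕ.* i) % k                      ≡⟨ cong (_% k) (ℕP.*-identityˡ i) ⟩
      i % k                              ≡⟨ m<n⇒m%n≡m i<k ⟩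
      i                                  ∎
      where open ≡-Reasoning

    -- r ↦ h r mod k is a permutation of Fin k fixing 0
    sumZ-permute-*-mod : ∀ h → Coprime h k → (g : ℕ → ℤ) → sumZ k (λ r → g ((h ℕ.* r) % k)) ≡ sumZ k g
    sumZ-permute-*-mod h cop g with mod-inverse h k' cop
    ... | h' , h'h≡1 = +-cancelˡ (g 0) _ _ (begin
      g 0 + sumZ k (λ r → g ((h ℕ.* r) % k))    ≡⟨ cong (λ z → g (z % k) + sumZ k (λ r → g ((h ℕ.* r) % k))) (sym (ℕP.*-zeroʳ h)) ⟩
      g ((h ℕ.* 0) % k) + sumZ k (λ r → g ((h ℕ.* r) % k))  ≡⟨ sym (sum-toℕ k' (λ r → g ((h ℕ.* r) % k))) ⟩
      sum {k} (λ i → g ((h ℕ.* toℕ i) % k))         ≡⟨ sum-cong-≗ {k} {λ i → g ((h ℕ.* toℕ i) % k)} {λ i → g (toℕ (π i))} (λ i → cong g (sym (toℕ-mod (h ℕ.* toℕ i)))) ⟩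
      sum {k} (λ i → g (toℕ (π i)))                 ≡⟨ sym (sum-permute (λ i → g (toℕ i)) (permutation π π⁻¹ π∘π⁻¹ π⁻¹∘π)) ⟩
      sum {k} (λ i → g (toℕ i))                     ≡⟨ sum-toℕ k' g ⟩
      g 0 + sumZ k g                            ∎)
      where
      open ≡-Reasoning
      toℕ-mod : ∀ n → toℕ (n mod k) ≡ n % k
      toℕ-mod n = FinP.toℕ-fromℕ< (m%n<n n k)
      π π⁻¹ : Fin k → Fin k
      π i = (h ℕ.* toℕ i) mod k
      π⁻¹ i = (h' ℕ.* toℕ i) mod k
      hh'≡1 : (h ℕ.* h') % k ≡ 1 % k
      hh'≡1 = trans (cong (_% k) (ℕP.*-comm h h')) h'h≡1
      π∘π⁻¹ : ∀ i → π (π⁻¹ i) ≡ i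
      π∘π⁻¹ i = FinP.toℕ-injective (trans (toℕ-mod (h ℕ.* toℕ (π⁻¹ i))) (trans (cong (λ z → (h ℕ.* z) % k) (toℕ-mod (h' ℕ.* toℕ i)))
                  (*-%-cancel h h' (toℕ i) hh'≡1 (FinP.toℕ<n i))))
      π⁻¹∘π : ∀ i → π⁻¹ (π i) ≡ i
      π⁻¹∘π i = FinP.toℕ-injective (trans (toℕ-mod (h' ℕ.* toℕ (π i))) (trans (cong (λ z → (h' ℕ.* z) % k) (toℕ-mod (h ℕ.* toℕ i)))
                  (*-%-cancel h' h (toℕ i) h'h≡1 (FinP.toℕ<n i))))

  ⌊_*_/_⌋ : ℕ → ℕ → (k : ℕ) → .{{NonZero k}} → ℤ
  ⌊ h * r / k ⌋ = + (h ℕ.* r / k)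

  floorSum weightedFloorSum floorSquareSum : ℕ → (k : ℕ) → .{{NonZero k}} → ℤ
  floorSum h k         = sumZ k (λ r → ⌊ h * r / k ⌋)
  weightedFloorSum h k = sumZ k (λ r → + r * ⌊ h * r / k ⌋)
  floorSquareSum h k   = sumZ k (λ r → ⌊ h * r / k ⌋ * ⌊ h * r / k ⌋)

  %≡-⌊/⌋ : ∀ a k .{{_ : NonZero k}} → + (a % k) ≡ + a - + k * + (a / k)
  %≡-⌊/⌋ a k = begin
    + (a % k)                                    ≡⟨ regroup (+ (a % k)) (+ (a / k)) (+ k) ⟩
    (+ (a % k) + + (a / k) * + k) - + k * + (a / k) ≡⟨ cong (_- + k * + (a / k)) (sym division) ⟩
    + a - + k * + (a / k)                        ∎
    where
    open ≡-Reasoning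
    regroup : ∀ a q k → a ≡ (a + q * k) - k * q
    regroup = solve-∀
    division : + a ≡ + (a % k) + + (a / k) * + k
    division = trans (cong +_ (m≡m%n+[m/n]*n a k))
                     (trans (ℤP.pos-+ (a % k) (a / k ℕ.* k)) (cong (λ z → + (a % k) + z) (ℤP.pos-* (a / k) k)))

  *%≡-⌊*/⌋ : ∀ h r k .{{_ : NonZero k}} → + (h ℕ.* r % k) ≡ + h * + r - + k * ⌊ h * r / k ⌋
  *%≡-⌊*/⌋ h r k = trans (%≡-⌊/⌋ (h ℕ.* r) k) (cong (λ z → z - + k * ⌊ h * r / k ⌋) (ℤP.pos-* h r))

  module _ (h k' : ℕ) (cop : Coprime h (suc k')) where

    private
      k = suc k'

    h*powerSum₁-k*floorSum : + h * powerSum₁ k - + k * floorSum h k ≡ powerSum₁ k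
    h*powerSum₁-k*floorSum = begin
      + h * powerSum₁ k - + k * floorSum h k                 ≡⟨ sym (sumZ-sub₂ k' (+ h) (+ k) (λ r → + r) (λ r → ⌊ h * r / k ⌋)) ⟩
      sumZ k (λ r → + h * + r - + k * ⌊ h * r / k ⌋)          ≡⟨ sumZ-cong k' (λ r _ → sym (*%≡-⌊*/⌋ h (suc r) k)) ⟩
      sumZ k (λ r → + (h ℕ.* r % k))                         ≡⟨ sumZ-permute-*-mod k' h cop (λ r → + r) ⟩
      powerSum₁ k                                            ∎
      where open ≡-Reasoning

    2*floorSum : + 2 * floorSum h k ≡ (+ h - + 1) * (+ k - + 1)
    2*floorSum = ℤP.*-cancelˡ-≡ (+ k) _ _
      (k*2B (+ h) (+ k') (powerSum₁ k) (floorSum h k) (2*powerSum₁ k') h*powerSum₁-k*floorSum)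
      where
      k*2B : ∀ h k' P B → + 2 * P ≡ k' * (k' + + 1) → h * P - (+ 1 + k') * B ≡ P →
             (+ 1 + k') * (+ 2 * B) ≡ (+ 1 + k') * ((h - + 1) * (+ 1 + k' - + 1))
      k*2B h k' P B 2P≡ hP-kB≡P = begin
        (+ 1 + k') * (+ 2 * B)                                    ≡⟨ solve (h ∷ k' ∷ P ∷ B ∷ []) ⟩
        (h - + 1) * (+ 2 * P) - + 2 * (h * P - (+ 1 + k') * B - P) ≡⟨ cong₂ (λ x y → (h - + 1) * x - + 2 * (y - P)) 2P≡ hP-kB≡P ⟩
        (h - + 1) * (k' * (k' + + 1)) - + 2 * (P - P)             ≡⟨ solve (h ∷ k' ∷ P ∷ []) ⟩
        (+ 1 + k') * ((h - + 1) * (+ 1 + k' - + 1))               ∎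
        where open ≡-Reasoning

    sum-squared-residues :
      + h * + h * powerSum₂ k + (- (+ 2 * + h * + k) * weightedFloorSum h k + + k * + k * floorSquareSum h k)
      ≡ powerSum₂ k
    sum-squared-residues = begin
      + h * + h * powerSum₂ k + (- (+ 2 * + h * + k) * weightedFloorSum h k + + k * + k * floorSquareSum h k)
        ≡⟨ sym (sumZ-lin₃ k' (+ h * + h) (- (+ 2 * + h * + k)) (+ k * + k) (λ r → + r * + r) (λ r → + r * q r) (λ r → q r * q r)) ⟩
      sumZ k (λ r → + h * + h * (+ r * + r) + (- (+ 2 * + h * + k) * (+ r * q r) + + k * + k * (q r * q r)))
        ≡⟨ sumZ-cong k' (λ r _ → sym (square-residue (suc r))) ⟩
      sumZ k (λ r → + (h ℕ.* r % k) * + (h ℕ.* r % k))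
        ≡⟨ sumZ-permute-*-mod k' h cop (λ y → + y * + y) ⟩
      powerSum₂ k ∎
      where
      open ≡-Reasoning
      q : ℕ → ℤ
      q r = ⌊ h * r / k ⌋
      expand : ∀ h k r q → (h * r - k * q) * (h * r - k * q) ≡ h * h * (r * r) + (- (+ 2 * h * k) * (r * q) + k * k * (q * q))
      expand = solve-∀
      square-residue : ∀ r → + (h ℕ.* r % k) * + (h ℕ.* r % k)
                           ≡ + h * + h * (+ r * + r) + (- (+ 2 * + h * + k) * (+ r * q r) + + k * + k * (q r * q r))
      square-residue r = trans (cong (λ z → z * z) (*%≡-⌊*/⌋ h r k)) (expand (+ h) (+ k) (+ r) (q r))

  *suc</⇒/≤ : ∀ h' k' r → r ℕ.< k' → suc h' ℕ.* suc r / suc k' ℕ.≤ h'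
  *suc</⇒/≤ h' k' r r<k' = ℕP.≤-pred (m<n*o⇒m/o<n (ℕP.*-monoʳ-< (suc h') (s≤s r<k')))

  <⇒∤ : ∀ k' r → r ℕ.< k' → ¬ (suc k' ∣ suc r)
  <⇒∤ k' r r<k' k∣r = ℕP.<⇒≱ (s≤s r<k') (∣⇒≤ k∣r)

  weighted-reciprocity-combination : ∀ h k A A' Q B P →
    h * h * P + (- (+ 2 * h * k) * A + k * k * Q) ≡ P →
    Q ≡ (k - + 1) * ((h - + 1) * (h - + 1)) - + 2 * A' + B →
    + 2 * B ≡ (k - + 1) * (h - + 1) →
    + 6 * P ≡ (k - + 1) * (k - + 1 + + 1) * (+ 2 * (k - + 1) + + 1) →
    k * (+ 12 * (h * A + k * A')) ≡ k * ((h - + 1) * (k - + 1) * (+ 8 * h * k - h - k - + 1))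
  weighted-reciprocity-combination h k A A' Q B P F2 Q≡ 2B≡ 6P≡ = begin
    k * (+ 12 * (h * A + k * A'))
      ≡⟨ solve (h ∷ k ∷ A ∷ A' ∷ Q ∷ P ∷ []) ⟩
    + 6 * (h * h * P + k * k * Q - (h * h * P + (- (+ 2 * h * k) * A + k * k * Q))) + + 12 * k * k * A'
      ≡⟨ cong₂ (λ x y → + 6 * (h * h * P + k * k * y - x) + + 12 * k * k * A') F2 Q≡ ⟩
    + 6 * (h * h * P + k * k * ((k - + 1) * ((h - + 1) * (h - + 1)) - + 2 * A' + B) - P) + + 12 * k * k * A'
      ≡⟨ solve (h ∷ k ∷ A' ∷ B ∷ P ∷ []) ⟩
    (h * h - + 1) * (+ 6 * P) + + 3 * k * k * (+ 2 * B) + + 6 * k * k * (k - + 1) * (h - + 1) * (h - + 1)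
      ≡⟨ cong₂ (λ x y → (h * h - + 1) * x + + 3 * k * k * y + + 6 * k * k * (k - + 1) * (h - + 1) * (h - + 1)) 6P≡ 2B≡ ⟩
    (h * h - + 1) * ((k - + 1) * (k - + 1 + + 1) * (+ 2 * (k - + 1) + + 1))
      + + 3 * k * k * ((k - + 1) * (h - + 1)) + + 6 * k * k * (k - + 1) * (h - + 1) * (h - + 1)
      ≡⟨ solve (h ∷ k ∷ []) ⟩
    k * ((h - + 1) * (k - + 1) * (+ 8 * h * k - h - k - + 1)) ∎
    where open ≡-Reasoning

  module _ (h' k' : ℕ) (cop : Coprime (suc h') (suc k')) where

    private
      h = suc h'
      k = suc k'

    -- q² = Σ_{s ≤ q} (2s - 1), and the double sum is swapped by counting lattice points
    floorSquareSum≡ : floorSquareSum h k ≡ + k' * (+ h' * + h') - + 2 * weightedFloorSum k h + floorSum k h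
    floorSquareSum≡ = begin
      floorSquareSum h k
        ≡⟨ sumZ-cong k' (λ r _ → sym (sum-odd (h ℕ.* suc r / k))) ⟩
      sumZ k (λ r → sumZ (suc (h ℕ.* r / k)) odd)
        ≡⟨ lattice-sum k h k' h' odd (*suc</⇒/≤ h' k') (*suc</⇒/≤ k' h') off-line ⟩
      sumZ h (λ s → odd s * (+ k' - ⌊ k * s / h ⌋))
        ≡⟨ sumZ-cong h' (λ s _ → expand (+ suc s) (+ k') ⌊ k * suc s / h ⌋) ⟩
      sumZ h (λ s → + 2 * + k' * + s + (- + 2 * (+ s * ⌊ k * s / h ⌋) + (+ 1 * ⌊ k * s / h ⌋ + - + k')))
        ≡⟨ sumZ-lin₃-const h' (+ 2 * + k') (- + 2) (+ 1) (- + k') (λ s → + s) (λ s → + s * ⌊ k * s / h ⌋) (λ s → ⌊ k * s / h ⌋) ⟩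
      + 2 * + k' * powerSum₁ h + (- + 2 * weightedFloorSum k h + (+ 1 * floorSum k h + + h' * - + k'))
        ≡⟨ collect (+ h') (+ k') (powerSum₁ h) (weightedFloorSum k h) (floorSum k h) (2*powerSum₁ h') ⟩
      + k' * (+ h' * + h') - + 2 * weightedFloorSum k h + floorSum k h ∎
      where
      open ≡-Reasoning
      odd : ℕ → ℤ
      odd s = + 2 * + s - + 1
      off-line : ∀ r s → r ℕ.< k' → s ℕ.< h' → k ℕ.* suc s ≢ h ℕ.* suc r
      off-line r s r<k' _ ks≡hr =
        <⇒∤ k' r r<k' (coprime-divisor (Coprime.sym cop) (divides (suc s) (trans (sym ks≡hr) (ℕP.*-comm k (suc s)))))
      expand : ∀ s k' q → (+ 2 * s - + 1) * (k' - q) ≡ + 2 * k' * s + (- + 2 * (s * q) + (+ 1 * q + - k'))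
      expand = solve-∀
      collect : ∀ h' k' P A B → + 2 * P ≡ h' * (h' + + 1) →
                + 2 * k' * P + (- + 2 * A + (+ 1 * B + h' * - k')) ≡ k' * (h' * h') - + 2 * A + B
      collect h' k' P A B 2P≡ = begin
        + 2 * k' * P + (- + 2 * A + (+ 1 * B + h' * - k')) ≡⟨ solve (h' ∷ k' ∷ P ∷ A ∷ B ∷ []) ⟩
        k' * (+ 2 * P) - h' * k' - + 2 * A + B               ≡⟨ cong (λ z → k' * z - h' * k' - + 2 * A + B) 2P≡ ⟩
        k' * (h' * (h' + + 1)) - h' * k' - + 2 * A + B       ≡⟨ solve (h' ∷ k' ∷ A ∷ B ∷ []) ⟩
        k' * (h' * h') - + 2 * A + B                         ∎

    weightedFloorSum-reciprocity :
      + 12 * (+ h * weightedFloorSum h k + + k * weightedFloorSum k h)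
      ≡ (+ h - + 1) * (+ k - + 1) * (+ 8 * + h * + k - + h - + k - + 1)
    weightedFloorSum-reciprocity = ℤP.*-cancelˡ-≡ (+ k) _ _
      (weighted-reciprocity-combination (+ h) (+ k) (weightedFloorSum h k) (weightedFloorSum k h) (floorSquareSum h k) (floorSum k h) (powerSum₂ k)
               (sum-squared-residues h k' cop) floorSquareSum≡ (2*floorSum k h' (Coprime.sym cop)) (6*powerSum₂ k'))

  -- sawℤ a k = 2k · ((a/k))
  sawResidue : ℕ → ℕ → ℤ
  sawResidue zero    k = + 0
  sawResidue (suc ρ) k = + 2 * + suc ρ - + k

  sawℤ : ℕ → (k : ℕ) → .{{NonZero k}} → ℤ
  sawℤ a k = sawResidue (a % k) k

  sawℤ-% : ∀ a k .{{_ : NonZero k}} → sawℤ (a % k) k ≡ sawℤ a k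
  sawℤ-% a k = cong (λ ρ → sawResidue ρ k) (m%n%n≡m%n a k)

  sawℤ-*% : ∀ h a k .{{_ : NonZero k}} → sawℤ (h ℕ.* (a % k)) k ≡ sawℤ (h ℕ.* a) k
  sawℤ-*% h a k = cong (λ ρ → sawResidue ρ k) (*-%-absorbʳ h a k)

  sawℤ-periodic : ∀ a n k .{{_ : NonZero k}} → sawℤ (a ℕ.+ n ℕ.* k) k ≡ sawℤ a k
  sawℤ-periodic a n k = cong (λ ρ → sawResidue ρ k) ([m+kn]%n≡m%n a n k)

  sawℤ-≢0 : ∀ a k .{{_ : NonZero k}} → a % k ≢ 0 → sawℤ a k ≡ + 2 * + (a % k) - + k
  sawℤ-≢0 a k ρ≢0 with a % k
  ... | zero  = ⊥-elim (ρ≢0 refl)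
  ... | suc ρ = refl

  sawℤ-< : ∀ r k .{{_ : NonZero k}} → 0 ℕ.< r → r ℕ.< k → sawℤ r k ≡ + 2 * + r - + k
  sawℤ-< r k 0<r r<k = trans (sawℤ-≢0 r k (λ r%k≡0 → ℕP.<⇒≢ 0<r (sym (trans (sym (m<n⇒m%n≡m r<k)) r%k≡0))))
                             (cong (λ z → + 2 * + z - + k) (m<n⇒m%n≡m r<k))

  sawResidue-double : ∀ ρ k → sawResidue (2 ℕ.* ρ) (2 ℕ.* k) ≡ + 2 * sawResidue ρ k
  sawResidue-double zero    k = refl
  sawResidue-double (suc ρ) k = begin
    sawResidue (2 ℕ.* suc ρ) (2 ℕ.* k)   ≡⟨ cong (λ n → sawResidue n (2 ℕ.* k)) (ℕP.*-suc 2 ρ) ⟩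
    + 2 * + (2 ℕ.+ 2 ℕ.* ρ) - + (2 ℕ.* k) ≡⟨ cong₂ (λ x y → + 2 * x - y) (ℤP.pos-+ 2 (2 ℕ.* ρ)) (ℤP.pos-* 2 k) ⟩
    + 2 * (+ 2 + + (2 ℕ.* ρ)) - + 2 * + k ≡⟨ cong (λ x → + 2 * (+ 2 + x) - + 2 * + k) (ℤP.pos-* 2 ρ) ⟩
    + 2 * (+ 2 + + 2 * + ρ) - + 2 * + k   ≡⟨ factor (+ ρ) (+ k) ⟩
    + 2 * (+ 2 * (+ 1 + + ρ) - + k)       ∎
    where
    open ≡-Reasoning
    factor : ∀ ρ k → + 2 * (+ 2 + + 2 * ρ) - + 2 * k ≡ + 2 * (+ 2 * (+ 1 + ρ) - k)
    factor = solve-∀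

  sawℤ-double : ∀ a k' → sawℤ (2 ℕ.* a) (2 ℕ.* suc k') ≡ + 2 * sawℤ a (suc k')
  sawℤ-double a k' = trans (cong (λ ρ → sawResidue ρ (2 ℕ.* k)) 2a%2k≡2[a%k]) (sawResidue-double (a % k) k)
    where
    k = suc k'
    2a%2k≡2[a%k] : (2 ℕ.* a) % (2 ℕ.* k) ≡ 2 ℕ.* (a % k)
    2a%2k≡2[a%k] = begin
      (2 ℕ.* a) % (2 ℕ.* k) ≡⟨ cong (_% (2 ℕ.* k)) (ℕP.*-comm 2 a) ⟩
      (a ℕ.* 2) % (2 ℕ.* k) ≡⟨ %-congʳ {o = a ℕ.* 2} (ℕP.*-comm 2 k) ⟩
      (a ℕ.* 2) % (k ℕ.* 2) ≡⟨ sym (m%n*o≡m*o%[n*o] a k 2) ⟩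
      a % k ℕ.* 2           ≡⟨ ℕP.*-comm (a % k) 2 ⟩
      2 ℕ.* (a % k)         ∎
      where open ≡-Reasoning

  -- dedekindℤ h k = 4k² · s(h, k)
  dedekindℤ : ℕ → (k : ℕ) → .{{NonZero k}} → ℤ
  dedekindℤ h k = sumZ k (λ r → sawℤ r k * sawℤ (h ℕ.* r) k)

  coprime⇒*%≢0 : ∀ h k' r → Coprime h (suc k') → r ℕ.< k' → (h ℕ.* suc r) % suc k' ≢ 0
  coprime⇒*%≢0 h k' r cop r<k' hr%k≡0 =
    <⇒∤ k' r r<k' (coprime-divisor (Coprime.sym cop) (m%n≡0⇒n∣m (h ℕ.* suc r) (suc k') hr%k≡0))

  dedekind-expansion-combination : ∀ h k P₂ A P₁ B → + 2 * P₁ ≡ (k - + 1) * (k - + 1 + + 1) → + 2 * B ≡ (h - + 1) * (k - + 1) →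
    + 4 * h * P₂ + (- (+ 4 * k) * A + (- (+ 2 * k + + 2 * h * k) * P₁ + (+ 2 * k * k * B + (k - + 1) * (k * k))))
    ≡ + 4 * h * P₂ - + 4 * k * A - k * k * (k - + 1)
  dedekind-expansion-combination h k P₂ A P₁ B 2P₁≡ 2B≡ = begin
    + 4 * h * P₂ + (- (+ 4 * k) * A + (- (+ 2 * k + + 2 * h * k) * P₁ + (+ 2 * k * k * B + (k - + 1) * (k * k))))
      ≡⟨ solve (h ∷ k ∷ P₂ ∷ A ∷ P₁ ∷ B ∷ []) ⟩
    + 4 * h * P₂ - + 4 * k * A - (k + h * k) * (+ 2 * P₁) + k * k * (+ 2 * B) + (k - + 1) * (k * k)
      ≡⟨ cong₂ (λ x y → + 4 * h * P₂ - + 4 * k * A - (k + h * k) * x + k * k * y + (k - + 1) * (k * k)) 2P₁≡ 2B≡ ⟩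
    + 4 * h * P₂ - + 4 * k * A - (k + h * k) * ((k - + 1) * (k - + 1 + + 1)) + k * k * ((h - + 1) * (k - + 1)) + (k - + 1) * (k * k)
      ≡⟨ solve (h ∷ k ∷ P₂ ∷ A ∷ []) ⟩
    + 4 * h * P₂ - + 4 * k * A - k * k * (k - + 1) ∎
    where open ≡-Reasoning

  module _ (h k' : ℕ) (cop : Coprime h (suc k')) where

    private
      k = suc k'

    dedekindℤ-expansion : dedekindℤ h k ≡ + 4 * + h * powerSum₂ k - + 4 * + k * weightedFloorSum h k - + k * + k * (+ k - + 1)
    dedekindℤ-expansion = begin
      dedekindℤ h k
        ≡⟨ sumZ-cong k' (λ r r<k' → pointwise (suc r) (s≤s z≤n) (s≤s r<k') (coprime⇒*%≢0 h k' r cop r<k')) ⟩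
      sumZ k (λ r → + 4 * + h * (+ r * + r) + (- (+ 4 * + k) * (+ r * q r)
                    + (- (+ 2 * + k + + 2 * + h * + k) * + r + (+ 2 * + k * + k * q r + + k * + k))))
        ≡⟨ sumZ-lin₄-const k' (+ 4 * + h) (- (+ 4 * + k)) (- (+ 2 * + k + + 2 * + h * + k)) (+ 2 * + k * + k) (+ k * + k)
                           (λ r → + r * + r) (λ r → + r * q r) (λ r → + r) q ⟩
      + 4 * + h * powerSum₂ k + (- (+ 4 * + k) * weightedFloorSum h k
        + (- (+ 2 * + k + + 2 * + h * + k) * powerSum₁ k + (+ 2 * + k * + k * floorSum h k + + k' * (+ k * + k))))
        ≡⟨ dedekind-expansion-combination (+ h) (+ k) (powerSum₂ k) (weightedFloorSum h k) (powerSum₁ k) (floorSum h k)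
                                 (2*powerSum₁ k') (2*floorSum h k' cop) ⟩
      + 4 * + h * powerSum₂ k - + 4 * + k * weightedFloorSum h k - + k * + k * (+ k - + 1) ∎
      where
      open ≡-Reasoning
      q : ℕ → ℤ
      q r = ⌊ h * r / k ⌋
      expand : ∀ h k r q → (+ 2 * r - k) * (+ 2 * (h * r - k * q) - k)
               ≡ + 4 * h * (r * r) + (- (+ 4 * k) * (r * q) + (- (+ 2 * k + + 2 * h * k) * r + (+ 2 * k * k * q + k * k)))
      expand = solve-∀
      pointwise : ∀ r → 0 ℕ.< r → r ℕ.< k → (h ℕ.* r) % k ≢ 0 → sawℤ r k * sawℤ (h ℕ.* r) k
                  ≡ + 4 * + h * (+ r * + r) + (- (+ 4 * + k) * (+ r * q r) + (- (+ 2 * + k + + 2 * + h * + k) * + r + (+ 2 * + k * + k * q r + + k * + k)))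
      pointwise r 0<r r<k hr%k≢0 = begin
        sawℤ r k * sawℤ (h ℕ.* r) k
          ≡⟨ cong₂ _*_ (sawℤ-< r k 0<r r<k) (sawℤ-≢0 (h ℕ.* r) k hr%k≢0) ⟩
        (+ 2 * + r - + k) * (+ 2 * + (h ℕ.* r % k) - + k)
          ≡⟨ cong (λ z → (+ 2 * + r - + k) * (+ 2 * z - + k)) (*%≡-⌊*/⌋ h r k) ⟩
        (+ 2 * + r - + k) * (+ 2 * (+ h * + r - + k * q r) - + k)
          ≡⟨ expand (+ h) (+ k) (+ r) (q r) ⟩
        _ ∎

  dedekind-reciprocity-combination : ∀ h k V V' P P' A A' →
    V ≡ + 4 * h * P - + 4 * k * A - k * k * (k - + 1) →
    V' ≡ + 4 * k * P' - + 4 * h * A' - h * h * (h - + 1) →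
    + 6 * P ≡ (k - + 1) * (k - + 1 + + 1) * (+ 2 * (k - + 1) + + 1) →
    + 6 * P' ≡ (h - + 1) * (h - + 1 + + 1) * (+ 2 * (h - + 1) + + 1) →
    + 12 * (h * A + k * A') ≡ (h - + 1) * (k - + 1) * (+ 8 * h * k - h - k - + 1) →
    + 3 * (h * h) * V + + 3 * (k * k) * V' ≡ h * k * (h * h + k * k + + 1) - + 3 * (h * h) * (k * k)
  dedekind-reciprocity-combination h k V V' P P' A A' V≡ V'≡ 6P≡ 6P'≡ 12A≡ = begin
    + 3 * (h * h) * V + + 3 * (k * k) * V'
      ≡⟨ cong₂ (λ x y → + 3 * (h * h) * x + + 3 * (k * k) * y) V≡ V'≡ ⟩
    + 3 * (h * h) * (+ 4 * h * P - + 4 * k * A - k * k * (k - + 1)) + + 3 * (k * k) * (+ 4 * k * P' - + 4 * h * A' - h * h * (h - + 1))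
      ≡⟨ solve (h ∷ k ∷ P ∷ P' ∷ A ∷ A' ∷ []) ⟩
    + 2 * h * h * h * (+ 6 * P) + + 2 * k * k * k * (+ 6 * P') - h * k * (+ 12 * (h * A + k * A')) - + 3 * h * h * k * k * (h + k - + 2)
      ≡⟨ cong (λ z → + 2 * h * h * h * (+ 6 * P) + + 2 * k * k * k * (+ 6 * P') - h * k * z - + 3 * h * h * k * k * (h + k - + 2)) 12A≡ ⟩
    + 2 * h * h * h * (+ 6 * P) + + 2 * k * k * k * (+ 6 * P')
      - h * k * ((h - + 1) * (k - + 1) * (+ 8 * h * k - h - k - + 1)) - + 3 * h * h * k * k * (h + k - + 2)
      ≡⟨ cong₂ (λ x y → + 2 * h * h * h * x + + 2 * k * k * k * y
                        - h * k * ((h - + 1) * (k - + 1) * (+ 8 * h * k - h - k - + 1)) - + 3 * h * h * k * k * (h + k - + 2)) 6P≡ 6P'≡ ⟩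
    + 2 * h * h * h * ((k - + 1) * (k - + 1 + + 1) * (+ 2 * (k - + 1) + + 1))
      + + 2 * k * k * k * ((h - + 1) * (h - + 1 + + 1) * (+ 2 * (h - + 1) + + 1))
      - h * k * ((h - + 1) * (k - + 1) * (+ 8 * h * k - h - k - + 1)) - + 3 * h * h * k * k * (h + k - + 2)
      ≡⟨ solve (h ∷ k ∷ []) ⟩
    h * k * (h * h + k * k + + 1) - + 3 * (h * h) * (k * k) ∎
    where open ≡-Reasoning

  dedekindℤ-reciprocity : ∀ h' k' → let h = suc h'; k = suc k' in Coprime h k →
    + 3 * (+ h * + h) * dedekindℤ h k + + 3 * (+ k * + k) * dedekindℤ k h
    ≡ + h * + k * (+ h * + h + + k * + k + + 1) - + 3 * (+ h * + h) * (+ k * + k)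
  dedekindℤ-reciprocity h' k' cop =
    dedekind-reciprocity-combination (+ suc h') (+ suc k') _ _ _ _ _ _
      (dedekindℤ-expansion (suc h') k' cop) (dedekindℤ-expansion (suc k') h' (Coprime.sym cop))
      (6*powerSum₂ k') (6*powerSum₂ h') (weightedFloorSum-reciprocity h' k' cop)

  sumZ-sawℤ : ∀ k' → sumZ (suc k') (λ r → sawℤ r (suc k')) ≡ + 0
  sumZ-sawℤ k' = begin
    sumZ k (λ r → sawℤ r k)                       ≡⟨ sumZ-cong k' (λ r r<k' → sawℤ-< (suc r) k (s≤s z≤n) (s≤s r<k')) ⟩
    sumZ k (λ r → + 2 * + r - + k)                ≡⟨ sumZ-+ k' (λ r → + 2 * + r) (λ _ → - + k) ⟩
    sumZ k (λ r → + 2 * + r) + sumZ k (λ _ → - + k) ≡⟨ cong₂ _+_ (sumZ-* k' (+ 2) (λ r → + r)) (sumZ-const k' (- + k)) ⟩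
    + 2 * powerSum₁ k + + k' * - + k              ≡⟨ cong (λ z → z + + k' * - + k) (2*powerSum₁ k') ⟩
    + k' * (+ k' + + 1) + + k' * - + k            ≡⟨ cancel (+ k') ⟩
    + 0                                           ∎
    where
    open ≡-Reasoning
    k = suc k'
    cancel : ∀ k' → k' * (k' + + 1) + k' * - (+ 1 + k') ≡ + 0
    cancel = solve-∀

  sumZ-sawℤ-* : ∀ a k' → Coprime a (suc k') → sumZ (suc k') (λ r → sawℤ (a ℕ.* r) (suc k')) ≡ + 0
  sumZ-sawℤ-* a k' cop = begin
    sumZ k (λ r → sawℤ (a ℕ.* r) k)        ≡⟨ sumZ-cong k' (λ r _ → sym (sawℤ-% (a ℕ.* suc r) k)) ⟩
    sumZ k (λ r → sawℤ ((a ℕ.* r) % k) k)  ≡⟨ sumZ-permute-*-mod k' a cop (λ y → sawℤ y k) ⟩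
    sumZ k (λ r → sawℤ r k)                ≡⟨ sumZ-sawℤ k' ⟩
    + 0                                    ∎
    where
    open ≡-Reasoning
    k = suc k'

  sawℤ-half : ∀ k' → sawℤ (suc k') (2 ℕ.* suc k') ≡ + 0
  sawℤ-half k' = begin
    sawℤ k (2 ℕ.* k)            ≡⟨ sawℤ-< k (2 ℕ.* k) (s≤s z≤n) (ℕP.m<m+n k (s≤s z≤n)) ⟩
    + 2 * + k - + (2 ℕ.* k)     ≡⟨ cong (λ z → + 2 * + k - z) (ℤP.pos-* 2 k) ⟩
    + 2 * + k - + 2 * + k       ≡⟨ ℤP.+-inverseʳ (+ 2 * + k) ⟩
    + 0                         ∎
    where
    open ≡-Reasoning
    k = suc k'

  module _ (h k' : ℕ) where

    private
      k = suc k'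
      term : ℕ → ℤ
      term r = sawℤ r (2 ℕ.* k) * sawℤ (2 ℕ.* h ℕ.* r) (2 ℕ.* k)

    -- the residues t and k + t modulo 2k pair up
    term-pair : ∀ t → 0 ℕ.< t → t ℕ.< k → term t + term (k ℕ.+ t) ≡ + 4 * (sawℤ t k * sawℤ (h ℕ.* t) k)
    term-pair t 0<t t<k = begin
      sawℤ t (2 ℕ.* k) * Y₂ + sawℤ (k ℕ.+ t) (2 ℕ.* k) * sawℤ (2 ℕ.* h ℕ.* (k ℕ.+ t)) (2 ℕ.* k)
        ≡⟨ cong (λ n → sawℤ t (2 ℕ.* k) * Y₂ + sawℤ (k ℕ.+ t) (2 ℕ.* k) * sawℤ n (2 ℕ.* k)) (shift h k t) ⟩
      sawℤ t (2 ℕ.* k) * Y₂ + sawℤ (k ℕ.+ t) (2 ℕ.* k) * sawℤ (2 ℕ.* h ℕ.* t ℕ.+ h ℕ.* (2 ℕ.* k)) (2 ℕ.* k)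
        ≡⟨ cong (λ z → sawℤ t (2 ℕ.* k) * Y₂ + sawℤ (k ℕ.+ t) (2 ℕ.* k) * z) (sawℤ-periodic (2 ℕ.* h ℕ.* t) h (2 ℕ.* k)) ⟩
      sawℤ t (2 ℕ.* k) * Y₂ + sawℤ (k ℕ.+ t) (2 ℕ.* k) * Y₂
        ≡⟨ cong₂ (λ x y → x * Y₂ + y * Y₂) (sawℤ-< t (2 ℕ.* k) 0<t t<2k) (sawℤ-< (k ℕ.+ t) (2 ℕ.* k) 0<k+t k+t<2k) ⟩
      (+ 2 * + t - + (2 ℕ.* k)) * Y₂ + (+ 2 * + (k ℕ.+ t) - + (2 ℕ.* k)) * Y₂
        ≡⟨ cong₂ (λ x y → (+ 2 * + t - x) * y + (+ 2 * + (k ℕ.+ t) - x) * y) (ℤP.pos-* 2 k) Y₂≡ ⟩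
      (+ 2 * + t - + 2 * + k) * (+ 2 * Y) + (+ 2 * + (k ℕ.+ t) - + 2 * + k) * (+ 2 * Y)
        ≡⟨ cong (λ z → (+ 2 * + t - + 2 * + k) * (+ 2 * Y) + (+ 2 * z - + 2 * + k) * (+ 2 * Y)) (ℤP.pos-+ k t) ⟩
      (+ 2 * + t - + 2 * + k) * (+ 2 * Y) + (+ 2 * (+ k + + t) - + 2 * + k) * (+ 2 * Y)
        ≡⟨ combine (+ t) (+ k) Y ⟩
      + 4 * ((+ 2 * + t - + k) * Y)
        ≡⟨ cong (λ z → + 4 * (z * Y)) (sym (sawℤ-< t k 0<t t<k)) ⟩
      + 4 * (sawℤ t k * Y) ∎
      where
      open ≡-Reasoning
      Y = sawℤ (h ℕ.* t) k
      Y₂ = sawℤ (2 ℕ.* h ℕ.* t) (2 ℕ.* k)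
      Y₂≡ : Y₂ ≡ + 2 * Y
      Y₂≡ = trans (cong (λ n → sawℤ n (2 ℕ.* k)) (ℕP.*-assoc 2 h t)) (sawℤ-double (h ℕ.* t) k')
      t<2k : t ℕ.< 2 ℕ.* k
      t<2k = ℕP.<-≤-trans t<k (ℕP.m≤m+n k _)
      0<k+t : 0 ℕ.< k ℕ.+ t
      0<k+t = ℕP.<-≤-trans 0<t (ℕP.m≤n+m t k)
      k+t<2k : k ℕ.+ t ℕ.< 2 ℕ.* k
      k+t<2k = ℕP.+-monoʳ-< k (subst (t ℕ.<_) (sym (ℕP.+-identityʳ k)) t<k)
      shift : ∀ h k t → 2 ℕ.* h ℕ.* (k ℕ.+ t) ≡ 2 ℕ.* h ℕ.* t ℕ.+ h ℕ.* (2 ℕ.* k)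
      shift = ℕ-Solver.solve-∀
      combine : ∀ t k Y → (+ 2 * t - + 2 * k) * (+ 2 * Y) + (+ 2 * (k + t) - + 2 * k) * (+ 2 * Y) ≡ + 4 * ((+ 2 * t - k) * Y)
      combine = solve-∀

    dedekindℤ-cancel-2 : dedekindℤ (2 ℕ.* h) (2 ℕ.* k) ≡ + 4 * dedekindℤ h k
    dedekindℤ-cancel-2 = begin
      sumZ (2 ℕ.* k) term
        ≡⟨ cong (λ n → sumZ n term) (2k≡ k') ⟩
      sumZ (suc (k ℕ.+ k')) term
        ≡⟨ sumZ-split k k' term ⟩
      sumZ k term + term k + sumZ k (λ t → term (k ℕ.+ t))
        ≡⟨ cong (λ z → sumZ k term + z + sumZ k (λ t → term (k ℕ.+ t))) term-k≡0 ⟩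
      sumZ k term + + 0 + sumZ k (λ t → term (k ℕ.+ t))
        ≡⟨ cong (_+ sumZ k (λ t → term (k ℕ.+ t))) (ℤP.+-identityʳ (sumZ k term)) ⟩
      sumZ k term + sumZ k (λ t → term (k ℕ.+ t))
        ≡⟨ sym (sumZ-+ k' term (λ t → term (k ℕ.+ t))) ⟩
      sumZ k (λ t → term t + term (k ℕ.+ t))
        ≡⟨ sumZ-cong k' (λ t t<k' → term-pair (suc t) (s≤s z≤n) (s≤s t<k')) ⟩
      sumZ k (λ t → + 4 * (sawℤ t k * sawℤ (h ℕ.* t) k))
        ≡⟨ sumZ-* k' (+ 4) (λ t → sawℤ t k * sawℤ (h ℕ.* t) k) ⟩
      + 4 * dedekindℤ h k ∎
      where
      open ≡-Reasoning
      2k≡ : ∀ k' → 2 ℕ.* suc k' ≡ suc (suc k' ℕ.+ k')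
      2k≡ = ℕ-Solver.solve-∀
      term-k≡0 : term k ≡ + 0
      term-k≡0 = trans (cong (_* sawℤ (2 ℕ.* h ℕ.* k) (2 ℕ.* k)) (sawℤ-half k')) (ℤP.*-zeroˡ (sawℤ (2 ℕ.* h ℕ.* k) (2 ℕ.* k)))

  coprime-*ˡ : ∀ {a b c} → Coprime (a ℕ.* b) c → Coprime a c
  coprime-*ˡ {b = b} cop (i∣a , i∣c) = cop (∣-trans i∣a (m∣m*n b) , i∣c)

  module _ (H : ℕ) where

    private
      c = suc (H ℕ.+ H)

    sawℤ-2*-odd : ∀ r y → 0 ℕ.< r → r ℕ.< c →
      sawℤ (2 ℕ.* r) c * y ≡ + 2 * (sawℤ r c * y) + (- + c * y + + 2 * + c * iverson (1 ℕ.* r ≤? H) y)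
    sawℤ-2*-odd r y 0<r r<c with 1 ℕ.* r ≤? H
    ... | yes r≤H = begin
      sawℤ (2 ℕ.* r) c * y               ≡⟨ cong (_* y) (sawℤ-< (2 ℕ.* r) c (ℕP.<-≤-trans 0<r (ℕP.m≤m+n r _)) 2r<c) ⟩
      (+ 2 * + (2 ℕ.* r) - + c) * y      ≡⟨ cong (λ z → (+ 2 * z - + c) * y) (ℤP.pos-* 2 r) ⟩
      (+ 2 * (+ 2 * + r) - + c) * y      ≡⟨ combine (+ r) (+ c) y ⟩
      + 2 * ((+ 2 * + r - + c) * y) + (- + c * y + + 2 * + c * y)
                                         ≡⟨ cong (λ z → + 2 * (z * y) + (- + c * y + + 2 * + c * y)) (sym (sawℤ-< r c 0<r r<c)) ⟩
      + 2 * (sawℤ r c * y) + (- + c * y + + 2 * + c * y) ∎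
      where
      open ≡-Reasoning
      2r<c : 2 ℕ.* r ℕ.< c
      2r<c = s≤s (subst (2 ℕ.* r ℕ.≤_) (cong (H ℕ.+_) (ℕP.+-identityʳ H))
                        (ℕP.*-monoʳ-≤ 2 (subst (ℕ._≤ H) (ℕP.*-identityˡ r) r≤H)))
      combine : ∀ r c y → (+ 2 * (+ 2 * r) - c) * y ≡ + 2 * ((+ 2 * r - c) * y) + (- c * y + + 2 * c * y)
      combine = solve-∀
    ... | no r≰H = begin
      sawℤ (2 ℕ.* r) c * y                         ≡⟨ cong (λ n → sawℤ n c * y) 2r≡ ⟩
      sawℤ (2 ℕ.* r ℕ.∸ c ℕ.+ 1 ℕ.* c) c * y        ≡⟨ cong (_* y) (sawℤ-periodic (2 ℕ.* r ℕ.∸ c) 1 c) ⟩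
      sawℤ (2 ℕ.* r ℕ.∸ c) c * y                   ≡⟨ cong (_* y) (sawℤ-< (2 ℕ.* r ℕ.∸ c) c 0<2r-c 2r-c<c) ⟩
      (+ 2 * + (2 ℕ.* r ℕ.∸ c) - + c) * y           ≡⟨ cong (λ z → (+ 2 * z - + c) * y) 2r-c≡ ⟩
      (+ 2 * (+ 2 * + r - + c) - + c) * y          ≡⟨ combine (+ r) (+ c) y ⟩
      + 2 * ((+ 2 * + r - + c) * y) + (- + c * y + + 2 * + c * + 0)
                                                   ≡⟨ cong (λ z → + 2 * (z * y) + (- + c * y + + 2 * + c * + 0)) (sym (sawℤ-< r c 0<r r<c)) ⟩
      + 2 * (sawℤ r c * y) + (- + c * y + + 2 * + c * + 0) ∎
      where
      open ≡-Reasoning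
      H<r : H ℕ.< r
      H<r = ℕP.≰⇒> (λ r≤H → r≰H (subst (ℕ._≤ H) (sym (ℕP.*-identityˡ r)) r≤H))
      c<2r : c ℕ.< 2 ℕ.* r
      c<2r = subst₂ ℕ._≤_ (cong suc (ℕP.+-suc H H)) (cong (r ℕ.+_) (sym (ℕP.+-identityʳ r))) (ℕP.+-mono-≤ H<r H<r)
      2r≡ : 2 ℕ.* r ≡ 2 ℕ.* r ℕ.∸ c ℕ.+ 1 ℕ.* c
      2r≡ = sym (trans (cong (2 ℕ.* r ℕ.∸ c ℕ.+_) (ℕP.*-identityˡ c)) (ℕP.m∸n+n≡m (ℕP.<⇒≤ c<2r)))
      0<2r-c : 0 ℕ.< 2 ℕ.* r ℕ.∸ c
      0<2r-c = ℕP.m<n⇒0<n∸m c<2r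
      2r-c<c : 2 ℕ.* r ℕ.∸ c ℕ.< c
      2r-c<c = ℕP.m<n+o⇒m∸n<o (2 ℕ.* r) c (subst (2 ℕ.* r ℕ.<_) (cong (c ℕ.+_) (ℕP.+-identityʳ c)) (ℕP.*-monoʳ-< 2 r<c))
      2r-c≡ : + (2 ℕ.* r ℕ.∸ c) ≡ + 2 * + r - + c
      2r-c≡ = sym (trans (cong (_- + c) (sym (ℤP.pos-* 2 r))) (trans (ℤP.m-n≡m⊖n (2 ℕ.* r) c) (ℤP.⊖-≥ (ℕP.<⇒≤ c<2r))))
      combine : ∀ r c y → (+ 2 * (+ 2 * r - c) - c) * y ≡ + 2 * ((+ 2 * r - c) * y) + (- c * y + + 2 * c * + 0)
      combine = solve-∀

    -- re-index by r ↦ 2r mod c; sawℤ(2r) - 2 sawℤ(r) is c for r ≤ H and -c for r > H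
    dedekindℤ-odd-modulus : ∀ h → Coprime (2 ℕ.* h) c →
      dedekindℤ h c ≡ + 2 * dedekindℤ (2 ℕ.* h) c + + 2 * + c * sumZ (suc H) (λ r → sawℤ (2 ℕ.* h ℕ.* r) c)
    dedekindℤ-odd-modulus h cop = begin
      dedekindℤ h c
        ≡⟨ sym (sumZ-permute-*-mod (H ℕ.+ H) 2 (coprime-*ˡ {b = h} cop) (λ y → sawℤ y c * sawℤ (h ℕ.* y) c)) ⟩
      sumZ c (λ r → sawℤ ((2 ℕ.* r) % c) c * sawℤ (h ℕ.* ((2 ℕ.* r) % c)) c)
        ≡⟨ sumZ-cong (H ℕ.+ H) (λ r _ → cong₂ _*_ (sawℤ-% (2 ℕ.* suc r) c) (trans (sawℤ-*% h (2 ℕ.* suc r) c) (cong (λ n → sawℤ n c) (2h≡ h (suc r))))) ⟩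
      sumZ c (λ r → sawℤ (2 ℕ.* r) c * Y r)
        ≡⟨ sumZ-cong (H ℕ.+ H) (λ r r<2H → sawℤ-2*-odd (suc r) (Y (suc r)) (s≤s z≤n) (s≤s r<2H)) ⟩
      sumZ c (λ r → + 2 * (sawℤ r c * Y r) + (- + c * Y r + + 2 * + c * iverson (1 ℕ.* r ≤? H) (Y r)))
        ≡⟨ sumZ-lin₃ (H ℕ.+ H) (+ 2) (- + c) (+ 2 * + c) (λ r → sawℤ r c * Y r) Y (λ r → iverson (1 ℕ.* r ≤? H) (Y r)) ⟩
      + 2 * dedekindℤ (2 ℕ.* h) c + (- + c * sumZ c Y + + 2 * + c * sumZ c (λ r → iverson (1 ℕ.* r ≤? H) (Y r)))
        ≡⟨ cong₂ (λ x y → + 2 * dedekindℤ (2 ℕ.* h) c + (- + c * x + + 2 * + c * y))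
                 (sumZ-sawℤ-* (2 ℕ.* h) (H ℕ.+ H) cop) first-half ⟩
      + 2 * dedekindℤ (2 ℕ.* h) c + (- + c * + 0 + + 2 * + c * sumZ (suc H) Y)
        ≡⟨ cong (λ z → + 2 * dedekindℤ (2 ℕ.* h) c + z)
                (trans (cong (_+ + 2 * + c * sumZ (suc H) Y) (ℤP.*-zeroʳ (- + c))) (ℤP.+-identityˡ _)) ⟩
      + 2 * dedekindℤ (2 ℕ.* h) c + + 2 * + c * sumZ (suc H) Y ∎
      where
      open ≡-Reasoning
      Y : ℕ → ℤ
      Y r = sawℤ (2 ℕ.* h ℕ.* r) c
      2h≡ : ∀ h r → h ℕ.* (2 ℕ.* r) ≡ 2 ℕ.* h ℕ.* r
      2h≡ = ℕ-Solver.solve-∀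
      first-half : sumZ c (λ r → iverson (1 ℕ.* r ≤? H) (Y r)) ≡ sumZ (suc H) Y
      first-half = trans (sum-iverson-≤ 1 H Y (H ℕ.+ H) (subst (ℕ._≤ H ℕ.+ H) (sym (n/1≡n H)) (ℕP.m≤m+n H H)))
                         (cong (λ n → sumZ (suc n) Y) (n/1≡n H))

  negOnePow-% : ∀ n → negOnePow (+ n) ≡ + 1 - + 2 * + (n % 2)
  negOnePow-% n with n % 2 | m%n<n n 2
  ... | 0 | _ = refl
  ... | 1 | _ = refl
  ... | suc (suc _) | s≤s (s≤s ())

  coprime-*ʳ : ∀ {a b c} → Coprime (a ℕ.* b) c → Coprime b c
  coprime-*ʳ {a} cop (i∣b , i∣c) = cop (∣-trans i∣b (n∣m*n a) , i∣c)

  S₄ℤ : ℕ → (k : ℕ) → .{{NonZero k}} → ℤ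
  S₄ℤ h k = sumZ k (λ j → negOnePow (+ (j ℕ.* h / k)))

  2*X-combination : ∀ c m H m' X P D C S B → c ≡ + 1 + (H + H) → m ≡ + 1 + m' →
    X ≡ + 2 * (+ 2 * m) * P + (- (+ 2 * c) * D + H * - c) →
    + 2 * P ≡ H * (H + + 1) →
    D + C ≡ m' * H →
    S ≡ - + 2 * B + (+ 4 * C + m' * + 1) →
    + 2 * B ≡ (c - + 1) * (m - + 1) →
    + 2 * X ≡ c - m + c * S
  2*X-combination c m H m' X P D C S B refl refl X≡ 2P≡ D+C≡ S≡ 2B≡ = begin
    + 2 * X
      ≡⟨ cong (+ 2 *_) X≡ ⟩
    + 2 * (+ 2 * (+ 2 * m) * P + (- (+ 2 * c) * D + H * - c))
      ≡⟨ solve (H ∷ m' ∷ P ∷ D ∷ C ∷ []) ⟩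
    + 4 * m * (+ 2 * P) - + 4 * c * (D + C) + + 4 * c * C - + 2 * H * c
      ≡⟨ cong₂ (λ x y → + 4 * m * x - + 4 * c * y + + 4 * c * C - + 2 * H * c) 2P≡ D+C≡ ⟩
    + 4 * m * (H * (H + + 1)) - + 4 * c * (m' * H) + + 4 * c * C - + 2 * H * c
      ≡⟨ solve (H ∷ m' ∷ C ∷ []) ⟩
    c - m - c * ((c - + 1) * (m - + 1)) + c * (+ 4 * C + m' * + 1)
      ≡⟨ cong (λ z → c - m - c * z + c * (+ 4 * C + m' * + 1)) (sym 2B≡) ⟩
    c - m - c * (+ 2 * B) + c * (+ 4 * C + m' * + 1)
      ≡⟨ solve (H ∷ m' ∷ B ∷ C ∷ []) ⟩
    c - m + c * (- + 2 * B + (+ 4 * C + m' * + 1))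
      ≡⟨ cong (λ z → c - m + c * z) (sym S≡) ⟩
    c - m + c * S ∎
    where open ≡-Reasoning

  dedekind-identity-combination : ∀ m c V₁ V₂ V₃ W X S →
    V₂ ≡ + 2 * V₁ + + 2 * c * X →
    W ≡ + 4 * V₃ →
    + 3 * (m * m) * V₂ + + 3 * (c * c) * V₃ ≡ m * c * (m * m + c * c + + 1) - + 3 * (m * m) * (c * c) →
    + 2 * X ≡ c - m + c * S →
    let d = + 2 * m in
    + 6 * (d * d) * V₁ + + 3 * (c * c) * W ≡ + 2 * c * d * (d * d + c * c + + 1) - + 6 * (c * c) * (d * d) - + 3 * (c * c) * (d * d) * S
  dedekind-identity-combination m c V₁ _ V₃ _ X S refl refl reciprocity 2X≡ = begin
    + 6 * (+ 2 * m * (+ 2 * m)) * V₁ + + 3 * (c * c) * (+ 4 * V₃)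
      ≡⟨ solve (m ∷ c ∷ V₁ ∷ V₃ ∷ X ∷ []) ⟩
    + 4 * (+ 3 * (m * m) * (+ 2 * V₁ + + 2 * c * X) + + 3 * (c * c) * V₃) - + 12 * m * m * c * (+ 2 * X)
      ≡⟨ cong₂ (λ x y → + 4 * x - + 12 * m * m * c * y) reciprocity 2X≡ ⟩
    + 4 * (m * c * (m * m + c * c + + 1) - + 3 * (m * m) * (c * c)) - + 12 * m * m * c * (c - m + c * S)
      ≡⟨ solve (m ∷ c ∷ S ∷ []) ⟩
    + 2 * c * (+ 2 * m) * (+ 2 * m * (+ 2 * m) + c * c + + 1) - + 6 * (c * c) * (+ 2 * m * (+ 2 * m))
      - + 3 * (c * c) * (+ 2 * m * (+ 2 * m)) * S ∎
    where open ≡-Reasoning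

  module _ (H m' : ℕ) (cop : Coprime (2 ℕ.* suc m') (suc (H ℕ.+ H))) where

    private
      c = suc (H ℕ.+ H)
      m = suc m'
      d = 2 ℕ.* m
      D C X : ℤ
      D = sumZ (suc H) (λ r → ⌊ d * r / c ⌋)
      C = sumZ m (λ j → ⌊ c * j / d ⌋)
      X = sumZ (suc H) (λ r → sawℤ (d ℕ.* r) c)

    X-expansion : X ≡ + 2 * + d * powerSum₁ (suc H) + (- (+ 2 * + c) * D + + H * - + c)
    X-expansion = trans (sumZ-cong H pointwise) (sumZ-lin₂-const H (+ 2 * + d) (- (+ 2 * + c)) (- + c) (λ r → + r) (λ r → ⌊ d * r / c ⌋))
      where
      expand : ∀ d r c q → + 2 * (d * r - c * q) - c ≡ + 2 * d * r + (- (+ 2 * c) * q + - c)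
      expand = solve-∀
      pointwise : ∀ r → r ℕ.< H → sawℤ (d ℕ.* suc r) c ≡ + 2 * + d * + suc r + (- (+ 2 * + c) * ⌊ d * suc r / c ⌋ + - + c)
      pointwise r r<H = trans (sawℤ-≢0 (d ℕ.* suc r) c (coprime⇒*%≢0 d (H ℕ.+ H) r cop (ℕP.<-≤-trans r<H (ℕP.m≤m+n H H))))
                              (trans (cong (λ z → + 2 * z - + c) (*%≡-⌊*/⌋ d (suc r) c)) (expand (+ d) (+ suc r) (+ c) ⌊ d * suc r / c ⌋))

    S₄ℤ-expansion : S₄ℤ c m ≡ - + 2 * floorSum c m + (+ 4 * C + + m' * + 1)
    S₄ℤ-expansion = trans (sumZ-cong m' (λ j _ → pointwise (suc j))) (sumZ-lin₂-const m' (- + 2) (+ 4) (+ 1) (λ j → ⌊ c * j / m ⌋) (λ j → ⌊ c * j / d ⌋))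
      where
      regroup : ∀ n q → + 1 - + 2 * (n - + 2 * q) ≡ - + 2 * n + (+ 4 * q + + 1)
      regroup = solve-∀
      pointwise : ∀ j → negOnePow (+ (j ℕ.* c / m)) ≡ - + 2 * ⌊ c * j / m ⌋ + (+ 4 * ⌊ c * j / d ⌋ + + 1)
      pointwise j = begin
        negOnePow (+ n)                            ≡⟨ negOnePow-% n ⟩
        + 1 - + 2 * + (n % 2)                      ≡⟨ cong (λ z → + 1 - + 2 * z) (%≡-⌊/⌋ n 2) ⟩
        + 1 - + 2 * (+ n - + 2 * + (n / 2))        ≡⟨ cong₂ (λ u v → + 1 - + 2 * (+ u - + 2 * + v)) n≡ n/2≡ ⟩
        + 1 - + 2 * (⌊ c * j / m ⌋ - + 2 * ⌊ c * j / d ⌋) ≡⟨ regroup ⌊ c * j / m ⌋ ⌊ c * j / d ⌋ ⟩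
        - + 2 * ⌊ c * j / m ⌋ + (+ 4 * ⌊ c * j / d ⌋ + + 1) ∎
        where
        open ≡-Reasoning
        n = j ℕ.* c / m
        n≡ : n ≡ c ℕ.* j / m
        n≡ = cong (_/ m) (ℕP.*-comm j c)
        n/2≡ : n / 2 ≡ c ℕ.* j / d
        n/2≡ = trans (m/n/o≡m/[n*o] (j ℕ.* c) m 2)
                     (trans (/-congʳ {m = j ℕ.* c} (ℕP.*-comm m 2)) (cong (_/ d) (ℕP.*-comm j c)))

    private
      column-bound : ∀ r → r ℕ.< H → d ℕ.* suc r / c ℕ.≤ m'
      column-bound r r<H = ℕP.≤-pred (m<n*o⇒m/o<n dr<mc)
        where
        2r<c : 2 ℕ.* suc r ℕ.< c
        2r<c = s≤s (subst (2 ℕ.* suc r ℕ.≤_) (cong (H ℕ.+_) (ℕP.+-identityʳ H)) (ℕP.*-monoʳ-≤ 2 r<H))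
        dr<mc : d ℕ.* suc r ℕ.< m ℕ.* c
        dr<mc = subst (ℕ._< m ℕ.* c) (regroup m (suc r)) (ℕP.*-monoʳ-< m 2r<c)
          where
          regroup : ∀ m r → m ℕ.* (2 ℕ.* r) ≡ 2 ℕ.* m ℕ.* r
          regroup = ℕ-Solver.solve-∀
      row-bound : ∀ s → s ℕ.< m' → c ℕ.* suc s / d ℕ.≤ H
      row-bound s s<m' = ℕP.≤-pred (m<n*o⇒m/o<n (ℕP.<-≤-trans (ℕP.*-monoʳ-< c (s≤s s<m')) cm≤[H+1]d))
        where
        [H+1]d≡ : ∀ H m → suc H ℕ.* (2 ℕ.* m) ≡ suc (H ℕ.+ H) ℕ.* m ℕ.+ m
        [H+1]d≡ = ℕ-Solver.solve-∀
        cm≤[H+1]d : c ℕ.* m ℕ.≤ suc H ℕ.* d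
        cm≤[H+1]d = subst (c ℕ.* m ℕ.≤_) (sym ([H+1]d≡ H m)) (ℕP.m≤m+n (c ℕ.* m) m)
      off-line : ∀ r s → r ℕ.< H → s ℕ.< m' → c ℕ.* suc s ≢ d ℕ.* suc r
      off-line r s r<H _ cs≡dr = <⇒∤ (H ℕ.+ H) r (ℕP.<-≤-trans r<H (ℕP.m≤m+n H H))
        (coprime-divisor (Coprime.sym cop) (divides (suc s) (trans (sym cs≡dr) (ℕP.*-comm c (suc s)))))

    -- D and C count the lattice points of the H × m' box on either side of the line d y = c x
    lattice-count : D + C ≡ + m' * + H
    lattice-count = begin
      D + C
        ≡⟨ cong (_+ C) (sumZ-cong H (λ r _ → sym (sum-ones (d ℕ.* suc r / c)))) ⟩
      sumZ (suc H) (λ r → sumZ (suc (d ℕ.* r / c)) (λ _ → + 1)) + C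
        ≡⟨ cong (_+ C) (lattice-sum c d H m' (λ _ → + 1) column-bound row-bound off-line) ⟩
      sumZ m (λ s → + 1 * (+ H - ⌊ c * s / d ⌋)) + C
        ≡⟨ cong (_+ C) (sumZ-cong m' (λ s _ → ℤP.*-identityˡ (+ H - ⌊ c * suc s / d ⌋))) ⟩
      sumZ m (λ s → + H - ⌊ c * s / d ⌋) + C
        ≡⟨ cong (_+ C) (trans (sumZ-+ m' (λ _ → + H) (λ s → - ⌊ c * s / d ⌋)) (cong₂ _+_ (sumZ-const m' (+ H)) (sumZ-neg m' _))) ⟩
      + m' * + H - C + C
        ≡⟨ //-rightDividesˡ C (+ m' * + H) ⟩
      + m' * + H ∎
      where
      open ≡-Reasoning
      sum-ones : ∀ n → sumZ (suc n) (λ _ → + 1) ≡ + n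
      sum-ones n = trans (sumZ-const n (+ 1)) (ℤP.*-identityʳ (+ n))

    2*X≡ : + 2 * X ≡ + c - + m + + c * S₄ℤ c m
    2*X≡ = 2*X-combination (+ c) (+ m) (+ H) (+ m') X (powerSum₁ (suc H)) D C (S₄ℤ c m) (floorSum c m) refl refl
             X-expansion (2*powerSum₁ H) lattice-count S₄ℤ-expansion (2*floorSum c m' (Coprime.sym (coprime-*ʳ {2} cop)))

    dedekindℤ-identity :
      + 6 * (+ d * + d) * dedekindℤ d c + + 3 * (+ c * + c) * dedekindℤ (2 ℕ.* c) d
      ≡ + 2 * + c * + d * (+ d * + d + + c * + c + + 1) - + 6 * (+ c * + c) * (+ d * + d) - + 3 * (+ c * + c) * (+ d * + d) * S₄ℤ c m
    dedekindℤ-identity =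
      dedekind-identity-combination (+ m) (+ c) (dedekindℤ d c) (dedekindℤ m c) (dedekindℤ c m) (dedekindℤ (2 ℕ.* c) d) X (S₄ℤ c m)
        (dedekindℤ-odd-modulus H m cop) (dedekindℤ-cancel-2 c m')
        (dedekindℤ-reciprocity m' (H ℕ.+ H) (coprime-*ʳ {2} cop)) 2*X≡

module RationalValued where

  open import Defs
  open IntegerValued using (sawResidue; sawℤ; dedekindℤ; S₄ℤ; %≡-⌊/⌋; sumZ-cong)
  open import Data.Nat as ℕ using (ℕ; zero; suc; NonZero)
  import Data.Nat.Properties as ℕP
  open import Data.Nat.DivMod using (m*n/o*n≡m/o; /-congʳ)
  open import Data.Integer as ℤ using (ℤ; +_; -[1+_]; _+_; _*_; -_; _-_)
  import Data.Integer.Properties as ℤP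
  open import Data.Integer.Tactic.RingSolver using (solve-∀)
  open import Data.Rational as ℚ using (ℚ; mkℚ; _/_; toℚᵘ; floor; _≟_; ½; 0ℚ)
  import Data.Rational.Properties as ℚP
  open import Data.Rational.Unnormalised as ℚᵘ using (mkℚᵘ; *≡*)
  import Data.Rational.Unnormalised.Properties as ℚᵘP
  open import Algebra.Properties.Group ℚP.+-0-group using (x∙y⁻¹≈ε⇒x≈y; x≈y⇒x∙y⁻¹≈ε)
  open import Data.Bool using (true; false; if_then_else_)
  open import Relation.Binary.PropositionalEquality
  open import Relation.Nullary using (does)
  open import Relation.Nullary.Decidable using (dec-true; dec-false)

  /-cross : ∀ a b p q → a * + suc q ≡ b * + suc p → a / suc p ≡ b / suc q
  /-cross a b p q cross = ℚP.fromℚᵘ-cong {mkℚᵘ a p} {mkℚᵘ b q} (*≡* cross)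

  /-cross⁻¹ : ∀ a b p q → a / suc p ≡ b / suc q → a * + suc q ≡ b * + suc p
  /-cross⁻¹ a b p q eq with ℚP./-injective-≃ (mkℚᵘ a p) (mkℚᵘ b q) eq
  ... | *≡* cross = cross

  toℚᵘ-/ : ∀ a n → toℚᵘ (a / suc n) ℚᵘ.≃ mkℚᵘ a n
  toℚᵘ-/ a n = ℚP.toℚᵘ-fromℚᵘ (mkℚᵘ a n)

  /+/ : ∀ a b p q → (a / suc p) ℚ.+ (b / suc q) ≡ (a * + suc q + b * + suc p) / (suc p ℕ.* suc q)
  /+/ a b p q = ℚP.toℚᵘ-injective (ℚᵘP.≃-trans (ℚP.toℚᵘ-homo-+ (a / suc p) (b / suc q))
    (ℚᵘP.≃-trans (ℚᵘP.+-cong (toℚᵘ-/ a p) (toℚᵘ-/ b q)) (ℚᵘP.≃-sym (toℚᵘ-/ _ (q ℕ.+ p ℕ.* suc q)))))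

  /*/ : ∀ a b p q → (a / suc p) ℚ.* (b / suc q) ≡ (a * b) / (suc p ℕ.* suc q)
  /*/ a b p q = ℚP.toℚᵘ-injective (ℚᵘP.≃-trans (ℚP.toℚᵘ-homo-* (a / suc p) (b / suc q))
    (ℚᵘP.≃-trans (ℚᵘP.*-cong (toℚᵘ-/ a p) (toℚᵘ-/ b q)) (ℚᵘP.≃-sym (toℚᵘ-/ (a * b) (q ℕ.+ p ℕ.* suc q)))))

  -‿/ : ∀ a p → ℚ.- (a / suc p) ≡ (- a) / suc p
  -‿/ a p = ℚP.toℚᵘ-injective (ℚᵘP.≃-trans (ℚP.toℚᵘ-homo‿- (a / suc p))
    (ℚᵘP.≃-trans (ℚᵘP.-‿cong (toℚᵘ-/ a p)) (ℚᵘP.≃-sym (toℚᵘ-/ (- a) p))))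

  /-/ : ∀ a b p q → (a / suc p) ℚ.- (b / suc q) ≡ (a * + suc q + (- b) * + suc p) / (suc p ℕ.* suc q)
  /-/ a b p q = trans (cong ((a / suc p) ℚ.+_) (-‿/ b q)) (/+/ a (- b) p q)

  *≡*⇒/≡/ : ∀ n a K D .{{_ : NonZero K}} .{{_ : NonZero D}} → n ℕ.* K ≡ a ℕ.* D → n ℕ./ D ≡ a ℕ./ K
  *≡*⇒/≡/ n a (suc K) (suc D) nK≡aD = begin
    n ℕ./ suc D                            ≡⟨ sym (m*n/o*n≡m/o n (suc K) (suc D)) ⟩
    n ℕ.* suc K ℕ./ (suc D ℕ.* suc K)      ≡⟨ cong (ℕ._/ (suc D ℕ.* suc K)) nK≡aD ⟩
    a ℕ.* suc D ℕ./ (suc D ℕ.* suc K)      ≡⟨ /-congʳ {m = a ℕ.* suc D} (ℕP.*-comm (suc D) (suc K)) ⟩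
    a ℕ.* suc D ℕ./ (suc K ℕ.* suc D)      ≡⟨ m*n/o*n≡m/o a (suc D) (suc K) ⟩
    a ℕ./ suc K                            ∎
    where open ≡-Reasoning

  floor-/ : ∀ a k' → floor (+ a / suc k') ≡ + (a ℕ./ suc k')
  floor-/ a k' with + a / suc k' | toℚᵘ-/ (+ a) k'
  ... | mkℚ (+ n) d' _ | *≡* cross = trans (ℤP.*-identityˡ (+ (n ℕ./ suc d')))
    (cong +_ (*≡*⇒/≡/ n a (suc k') (suc d') (ℤP.+-injective (trans (ℤP.pos-* n (suc k')) (trans cross (sym (ℤP.pos-* a (suc d'))))))))
  ... | mkℚ -[1+ n ] d' _ | *≡* cross with trans cross (sym (ℤP.pos-* a (suc d')))
  ... | ()

  module _ (a k' : ℕ) where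

    private
      k = suc k'
      x = + a / k

    fractional-part : x ℚ.- toℚ (floor x) ≡ + (a ℕ.% k) / k
    fractional-part = begin
      x ℚ.- toℚ (floor x)               ≡⟨ cong (λ z → x ℚ.- toℚ z) (floor-/ a k') ⟩
      x ℚ.- + (a ℕ./ k) / 1             ≡⟨ /-/ (+ a) (+ (a ℕ./ k)) k' 0 ⟩
      (+ a * + 1 + - + (a ℕ./ k) * + k) / (k ℕ.* 1)
                                        ≡⟨ /-cross (+ a * + 1 + - + (a ℕ./ k) * + k) (+ (a ℕ.% k)) (k' ℕ.* 1) k' cross ⟩
      + (a ℕ.% k) / k                   ∎
      where
      open ≡-Reasoning
      regroup : ∀ a q k → (a * + 1 + - q * k) * k ≡ (a - k * q) * (k * + 1)
      regroup = solve-∀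
      cross : (+ a * + 1 + - + (a ℕ./ k) * + k) * + k ≡ + (a ℕ.% k) * + (k ℕ.* 1)
      cross = trans (regroup (+ a) (+ (a ℕ./ k)) (+ k))
                    (cong₂ _*_ (sym (%≡-⌊/⌋ a k)) (sym (ℤP.pos-* k 1)))

    saw-/ : saw x ≡ sawℤ a k / (2 ℕ.* k)
    saw-/ = saw-residue (a ℕ.% k) fractional-part
      where
      open ≡-Reasoning
      t = toℚ (floor x)
      saw-if : ∀ b → does (x ≟ t) ≡ b → saw x ≡ (if b then 0ℚ else (x ℚ.- t) ℚ.- ½)
      saw-if b eq = cong (λ b → if b then 0ℚ else (x ℚ.- t) ℚ.- ½) eq
      saw-residue : ∀ ρ → x ℚ.- t ≡ + ρ / k → saw x ≡ sawResidue ρ k / (2 ℕ.* k)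
      saw-residue zero x-t≡0 = begin
        saw x                ≡⟨ saw-if true (dec-true (x ≟ t) (x∙y⁻¹≈ε⇒x≈y x t (trans x-t≡0 (ℚP.0/n≡0 k)))) ⟩
        0ℚ                   ≡⟨ sym (ℚP.0/n≡0 (2 ℕ.* k)) ⟩
        + 0 / (2 ℕ.* k)      ∎
      saw-residue (suc ρ) x-t≡ρ = begin
        saw x                ≡⟨ saw-if false (dec-false (x ≟ t) x≢t) ⟩
        (x ℚ.- t) ℚ.- ½      ≡⟨ cong (ℚ._- ½) x-t≡ρ ⟩
        + suc ρ / k ℚ.- ½    ≡⟨ /-/ (+ suc ρ) (+ 1) k' 1 ⟩
        (+ suc ρ * + 2 + - + 1 * + k) / (k ℕ.* 2)
                             ≡⟨ /-cross (+ suc ρ * + 2 + - + 1 * + k) (+ 2 * + suc ρ - + k) _ _ cross ⟩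
        (+ 2 * + suc ρ - + k) / (2 ℕ.* k) ∎
        where
        x≢t : x ≢ t
        x≢t x≡t with /-cross⁻¹ (+ suc ρ) (+ 0) k' 0 (trans (sym x-t≡ρ) (x≈y⇒x∙y⁻¹≈ε x≡t))
        ... | ()
        regroup : ∀ r k → (r * + 2 + - + 1 * k) * (+ 2 * k) ≡ (+ 2 * r - k) * (k * + 2)
        regroup = solve-∀
        cross : (+ suc ρ * + 2 + - + 1 * + k) * + (2 ℕ.* k) ≡ (+ 2 * + suc ρ - + k) * + (k ℕ.* 2)
        cross = begin
          (+ suc ρ * + 2 + - + 1 * + k) * + (2 ℕ.* k) ≡⟨ cong ((+ suc ρ * + 2 + - + 1 * + k) *_) (ℤP.pos-* 2 k) ⟩
          (+ suc ρ * + 2 + - + 1 * + k) * (+ 2 * + k) ≡⟨ regroup (+ suc ρ) (+ k) ⟩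
          (+ 2 * + suc ρ - + k) * (+ k * + 2)           ≡⟨ cong ((+ 2 * + suc ρ - + k) *_) (sym (ℤP.pos-* k 2)) ⟩
          (+ 2 * + suc ρ - + k) * + (k ℕ.* 2)             ∎

  sumQ-cong : ∀ n {f g : ℕ → ℚ} → (∀ r → r ℕ.< n → f (suc r) ≡ g (suc r)) → sumQ (suc n) f ≡ sumQ (suc n) g
  sumQ-cong zero    eq = refl
  sumQ-cong (suc n) eq = cong₂ ℚ._+_ (sumQ-cong n (λ r r<n → eq r (ℕP.m<n⇒m<1+n r<n))) (eq n (ℕP.n<1+n n))

  sumQ-/ : ∀ n (F : ℕ → ℤ) D → sumQ (suc n) (λ r → F r / suc D) ≡ sumZ (suc n) F / suc D
  sumQ-/ zero    F D = sym (ℚP.0/n≡0 (suc D))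
  sumQ-/ (suc n) F D = begin
    sumQ (suc n) (λ r → F r / suc D) ℚ.+ F (suc n) / suc D
      ≡⟨ cong (ℚ._+ F (suc n) / suc D) (sumQ-/ n F D) ⟩
    σ / suc D ℚ.+ F (suc n) / suc D
      ≡⟨ /+/ σ (F (suc n)) D D ⟩
    (σ * + suc D + F (suc n) * + suc D) / (suc D ℕ.* suc D)
      ≡⟨ /-cross (σ * + suc D + F (suc n) * + suc D) (σ + F (suc n)) (D ℕ.+ D ℕ.* suc D) D cross ⟩
    (σ + F (suc n)) / suc D ∎
    where
    open ≡-Reasoning
    σ = sumZ (suc n) F
    factor : ∀ s f d → (s * d + f * d) * d ≡ (s + f) * (d * d)
    factor = solve-∀
    cross : (σ * + suc D + F (suc n) * + suc D) * + suc D ≡ (σ + F (suc n)) * + (suc D ℕ.* suc D)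
    cross = trans (factor σ (F (suc n)) (+ suc D)) (cong ((σ + F (suc n)) *_) (sym (ℤP.pos-* (suc D) (suc D))))

  s≡dedekindℤ/ : ∀ h k' → s (+ h) (suc k') ≡ dedekindℤ h (suc k') / (2 ℕ.* suc k' ℕ.* (2 ℕ.* suc k'))
  s≡dedekindℤ/ h k' = trans (sumQ-cong k' pointwise) (sumQ-/ k' (λ r → sawℤ r k * sawℤ (h ℕ.* r) k) _)
    where
    k = suc k'
    pointwise : ∀ r → r ℕ.< k' → saw (frac (+ suc r) k) ℚ.* saw (frac (+ h * + suc r) k)
                                 ≡ (sawℤ (suc r) k * sawℤ (h ℕ.* suc r) k) / (2 ℕ.* k ℕ.* (2 ℕ.* k))
    pointwise r _ = trans (cong₂ ℚ._*_ (saw-/ (suc r) k') (trans (cong (λ z → saw (z / k)) (sym (ℤP.pos-* h (suc r)))) (saw-/ (h ℕ.* suc r) k')))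
                          (/*/ (sawℤ (suc r) k) (sawℤ (h ℕ.* suc r) k) _ _)

  S₄≡S₄ℤ : ∀ c m' → S₄ (+ c) (suc m') ≡ S₄ℤ c (suc m')
  S₄≡S₄ℤ c m' = sumZ-cong m' (λ j _ → cong negOnePow
    (trans (cong (λ z → floor (z / suc m')) (sym (ℤP.pos-* (suc j) c))) (floor-/ (suc j ℕ.* c) m')))

  module _ (c' d' : ℕ) (W₁ W₂ S : ℤ) where

    private
      c = suc c'
      d = suc d'
      A = 2 ℕ.* c ℕ.* (2 ℕ.* c)
      B = 2 ℕ.* d ℕ.* (2 ℕ.* d)
      E = 6 ℕ.* c ℕ.* d
      N = d ℕ.* d ℕ.+ c ℕ.* c ℕ.+ 1

      A≡ : + A ≡ + 2 * + c * (+ 2 * + c)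
      A≡ = trans (ℤP.pos-* (2 ℕ.* c) (2 ℕ.* c)) (cong₂ _*_ (ℤP.pos-* 2 c) (ℤP.pos-* 2 c))
      B≡ : + B ≡ + 2 * + d * (+ 2 * + d)
      B≡ = trans (ℤP.pos-* (2 ℕ.* d) (2 ℕ.* d)) (cong₂ _*_ (ℤP.pos-* 2 d) (ℤP.pos-* 2 d))
      E≡ : + E ≡ + 6 * + c * + d
      E≡ = trans (ℤP.pos-* (6 ℕ.* c) d) (cong (_* + d) (ℤP.pos-* 6 c))
      N≡ : + N ≡ + d * + d + + c * + c + + 1
      N≡ = trans (ℤP.pos-+ (d ℕ.* d ℕ.+ c ℕ.* c) 1)
                 (cong (_+ + 1) (trans (ℤP.pos-+ (d ℕ.* d) (c ℕ.* c)) (cong₂ _+_ (ℤP.pos-* d d) (ℤP.pos-* c c))))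

    IntegerIdentity : Set
    IntegerIdentity = + 6 * (+ d * + d) * W₁ + + 3 * (+ c * + c) * W₂
      ≡ + 2 * + c * + d * (+ d * + d + + c * + c + + 1) - + 6 * (+ c * + c) * (+ d * + d) - + 3 * (+ c * + c) * (+ d * + d) * S

    cross-multiplied : IntegerIdentity →
      (+ 2 * W₁ * + B + W₂ * + (1 ℕ.* A)) * + (E ℕ.* 2 ℕ.* (4 ℕ.* 1))
      ≡ ((+ N * + 2 + - + 1 * + E) * + (4 ℕ.* 1) + - (+ 1 * S) * + (E ℕ.* 2)) * + (1 ℕ.* A ℕ.* B)
    cross-multiplied integral = begin
      (+ 2 * W₁ * + B + W₂ * + (1 ℕ.* A)) * + (E ℕ.* 2 ℕ.* (4 ℕ.* 1))
        ≡⟨ cong₂ (λ x y → (+ 2 * W₁ * + B + W₂ * x) * y) (ℤP.pos-* 1 A)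
                 (trans (ℤP.pos-* (E ℕ.* 2) (4 ℕ.* 1)) (cong₂ _*_ (ℤP.pos-* E 2) (ℤP.pos-* 4 1))) ⟩
      (+ 2 * W₁ * + B + W₂ * (+ 1 * + A)) * (+ E * + 2 * (+ 4 * + 1))
        ≡⟨ cong₂ (λ x y → (+ 2 * W₁ * x + W₂ * (+ 1 * y)) * (+ E * + 2 * (+ 4 * + 1))) B≡ A≡ ⟩
      (+ 2 * W₁ * (+ 2 * + d * (+ 2 * + d)) + W₂ * (+ 1 * (+ 2 * + c * (+ 2 * + c)))) * (+ E * + 2 * (+ 4 * + 1))
        ≡⟨ cong (λ x → (+ 2 * W₁ * (+ 2 * + d * (+ 2 * + d)) + W₂ * (+ 1 * (+ 2 * + c * (+ 2 * + c)))) * (x * + 2 * (+ 4 * + 1))) E≡ ⟩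
      (+ 2 * W₁ * (+ 2 * + d * (+ 2 * + d)) + W₂ * (+ 1 * (+ 2 * + c * (+ 2 * + c)))) * (+ 6 * + c * + d * + 2 * (+ 4 * + 1))
        ≡⟨ expand-left (+ c) (+ d) W₁ W₂ ⟩
      + 64 * + c * + d * (+ 6 * (+ d * + d) * W₁ + + 3 * (+ c * + c) * W₂)
        ≡⟨ cong (+ 64 * + c * + d *_) integral ⟩
      + 64 * + c * + d * (+ 2 * + c * + d * (+ d * + d + + c * + c + + 1) - + 6 * (+ c * + c) * (+ d * + d) - + 3 * (+ c * + c) * (+ d * + d) * S)
        ≡⟨ expand-right (+ c) (+ d) S ⟩
      (((+ d * + d + + c * + c + + 1) * + 2 + - + 1 * (+ 6 * + c * + d)) * (+ 4 * + 1) + - (+ 1 * S) * (+ 6 * + c * + d * + 2))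
        * (+ 1 * (+ 2 * + c * (+ 2 * + c)) * (+ 2 * + d * (+ 2 * + d)))
        ≡⟨ cong₂ (λ x y → ((x * + 2 + - + 1 * y) * (+ 4 * + 1) + - (+ 1 * S) * (y * + 2)) * (+ 1 * (+ 2 * + c * (+ 2 * + c)) * (+ 2 * + d * (+ 2 * + d))))
                 (sym N≡) (sym E≡) ⟩
      ((+ N * + 2 + - + 1 * + E) * (+ 4 * + 1) + - (+ 1 * S) * (+ E * + 2)) * (+ 1 * (+ 2 * + c * (+ 2 * + c)) * (+ 2 * + d * (+ 2 * + d)))
        ≡⟨ cong₂ (λ x y → ((+ N * + 2 + - + 1 * + E) * (+ 4 * + 1) + - (+ 1 * S) * (+ E * + 2)) * (+ 1 * x * y)) (sym A≡) (sym B≡) ⟩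
      ((+ N * + 2 + - + 1 * + E) * (+ 4 * + 1) + - (+ 1 * S) * (+ E * + 2)) * (+ 1 * + A * + B)
        ≡⟨ cong₂ (λ x y → ((+ N * + 2 + - + 1 * + E) * x + - (+ 1 * S) * y) * (+ 1 * + A * + B)) (sym (ℤP.pos-* 4 1)) (sym (ℤP.pos-* E 2)) ⟩
      ((+ N * + 2 + - + 1 * + E) * + (4 ℕ.* 1) + - (+ 1 * S) * + (E ℕ.* 2)) * (+ 1 * + A * + B)
        ≡⟨ cong (((+ N * + 2 + - + 1 * + E) * + (4 ℕ.* 1) + - (+ 1 * S) * + (E ℕ.* 2)) *_)
                (sym (trans (ℤP.pos-* (1 ℕ.* A) B) (cong (_* + B) (ℤP.pos-* 1 A)))) ⟩
      ((+ N * + 2 + - + 1 * + E) * + (4 ℕ.* 1) + - (+ 1 * S) * + (E ℕ.* 2)) * + (1 ℕ.* A ℕ.* B) ∎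
      where
      open ≡-Reasoning
      expand-left : ∀ c d W₁ W₂ → (+ 2 * W₁ * (+ 2 * d * (+ 2 * d)) + W₂ * (+ 1 * (+ 2 * c * (+ 2 * c)))) * (+ 6 * c * d * + 2 * (+ 4 * + 1))
                    ≡ + 64 * c * d * (+ 6 * (d * d) * W₁ + + 3 * (c * c) * W₂)
      expand-left = solve-∀
      expand-right : ∀ c d S → + 64 * c * d * (+ 2 * c * d * (d * d + c * c + + 1) - + 6 * (c * c) * (d * d) - + 3 * (c * c) * (d * d) * S)
                     ≡ (((d * d + c * c + + 1) * + 2 + - + 1 * (+ 6 * c * d)) * (+ 4 * + 1) + - (+ 1 * S) * (+ 6 * c * d * + 2))
                       * (+ 1 * (+ 2 * c * (+ 2 * c)) * (+ 2 * d * (+ 2 * d)))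
      expand-right = solve-∀

    rational-identity : IntegerIdentity →
      toℚ (+ 2) ℚ.* (W₁ / A) ℚ.+ W₂ / B ≡ (frac (+ N) E ℚ.- ½) ℚ.- frac (+ 1) 4 ℚ.* toℚ S
    rational-identity integral = begin
      toℚ (+ 2) ℚ.* (W₁ / A) ℚ.+ W₂ / B
        ≡⟨ cong (ℚ._+ W₂ / B) (/*/ (+ 2) W₁ 0 _) ⟩
      (+ 2 * W₁) / (1 ℕ.* A) ℚ.+ W₂ / B
        ≡⟨ /+/ (+ 2 * W₁) W₂ _ _ ⟩
      (+ 2 * W₁ * + B + W₂ * + (1 ℕ.* A)) / (1 ℕ.* A ℕ.* B)
        ≡⟨ /-cross (+ 2 * W₁ * + B + W₂ * + (1 ℕ.* A)) ((+ N * + 2 + - + 1 * + E) * + (4 ℕ.* 1) + - (+ 1 * S) * + (E ℕ.* 2)) _ _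
                   (cross-multiplied integral) ⟩
      ((+ N * + 2 + - + 1 * + E) * + (4 ℕ.* 1) + - (+ 1 * S) * + (E ℕ.* 2)) / (E ℕ.* 2 ℕ.* (4 ℕ.* 1))
        ≡⟨ sym (/-/ (+ N * + 2 + - + 1 * + E) (+ 1 * S) _ _) ⟩
      (+ N * + 2 + - + 1 * + E) / (E ℕ.* 2) ℚ.- (+ 1 * S) / (4 ℕ.* 1)
        ≡⟨ cong₂ ℚ._-_ (sym (/-/ (+ N) (+ 1) _ 1)) (sym (/*/ (+ 1) S 3 0)) ⟩
      (+ N / E ℚ.- ½) ℚ.- frac (+ 1) 4 ℚ.* toℚ S ∎
      where open ≡-Reasoning

open import Defs
open IntegerValued using (dedekindℤ; S₄ℤ; dedekindℤ-identity)
open RationalValued using (s≡dedekindℤ/; S₄≡S₄ℤ; rational-identity)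
open import Data.Nat as ℕ using (ℕ; zero; suc; _≤_; _*_; _+_)
open import Data.Nat.Divisibility using (_∣_; divides; m%n≡0⇒n∣m)
open import Data.Nat.Coprimality using (Coprime)
open import Data.Integer as ℤ using (+_)
open import Data.Rational using (ℚ; ½; _-_; _/_)
open import Data.Rational as ℚ using ()
open import Relation.Binary.PropositionalEquality using (_≡_; _≢_; sym; trans; cong; cong₂; subst₂; module ≡-Reasoning)
import Data.Nat.Properties as ℕP
open import Data.Nat.DivMod using (m≡m%n+[m/n]*n; m%n<n; m*n/n≡m)
import Data.Nat.Tactic.RingSolver as ℕ-Solver
open import Data.Product using (_,_)
open import Data.Empty using (⊥-elim)

even-coprime⇒odd : ∀ {d c} → 2 ∣ d → Coprime d c → c ≡ suc (c ℕ./ 2 + c ℕ./ 2)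
even-coprime⇒odd {c = c} 2∣d cop = trans (m≡m%n+[m/n]*n c 2) (trans (cong (_+ c ℕ./ 2 * 2) c%2≡1) (cong suc (n*2≡n+n (c ℕ./ 2))))
  where
  c%2≢0 : c ℕ.% 2 ≢ 0
  c%2≢0 c%2≡0 with cop (2∣d , m%n≡0⇒n∣m c 2 c%2≡0)
  ... | ()
  c%2≡1 : c ℕ.% 2 ≡ 1
  c%2≡1 = ℕP.≤-antisym (ℕP.≤-pred (m%n<n c 2)) (ℕP.n≢0⇒n>0 c%2≢0)
  n*2≡n+n : ∀ n → n * 2 ≡ n + n
  n*2≡n+n = ℕ-Solver.solve-∀

DedekindSumIdentity : ℕ → ℕ → Set
DedekindSumIdentity d c =
  (toℚ (+ 2) ℚ.* s (+ d) c) ℚ.+ s (+ (2 * c)) d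
    ≡ (frac (+ (d * d + c * c + 1)) (6 * c * d) - ½) - frac (+ 1) 4 ℚ.* toℚ (S₄ (+ c) (d ℕ./ 2))

dedekindSumIdentity : ∀ H m' → Coprime (2 * suc m') (suc (H + H)) → DedekindSumIdentity (2 * suc m') (suc (H + H))
dedekindSumIdentity H m' cop = begin
  toℚ (+ 2) ℚ.* s (+ d) c ℚ.+ s (+ (2 * c)) d
    ≡⟨ cong₂ (λ x y → toℚ (+ 2) ℚ.* x ℚ.+ y) (s≡dedekindℤ/ d (H + H)) (s≡dedekindℤ/ (2 * c) (m' + 1 * suc m')) ⟩
  toℚ (+ 2) ℚ.* (dedekindℤ d c / (2 * c * (2 * c))) ℚ.+ dedekindℤ (2 * c) d / (2 * d * (2 * d))
    ≡⟨ rational-identity (H + H) (m' + 1 * suc m') (dedekindℤ d c) (dedekindℤ (2 * c) d) (S₄ℤ c m) (dedekindℤ-identity H m' cop) ⟩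
  (frac (+ (d * d + c * c + 1)) (6 * c * d) - ½) - frac (+ 1) 4 ℚ.* toℚ (S₄ℤ c m)
    ≡⟨ cong (λ z → (frac (+ (d * d + c * c + 1)) (6 * c * d) - ½) - frac (+ 1) 4 ℚ.* toℚ z) (sym S₄≡) ⟩
  (frac (+ (d * d + c * c + 1)) (6 * c * d) - ½) - frac (+ 1) 4 ℚ.* toℚ (S₄ (+ c) (d ℕ./ 2)) ∎
  where
  open ≡-Reasoning
  c = suc (H + H)
  m = suc m'
  d = 2 * m
  S₄≡ : S₄ (+ c) (d ℕ./ 2) ≡ S₄ℤ c m
  S₄≡ = trans (cong (S₄ (+ c)) (trans (cong (ℕ._/ 2) (ℕP.*-comm 2 m)) (m*n/n≡m m 2))) (S₄≡S₄ℤ c m')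

lemma2 : (d c : ℕ) → 1 ≤ d → 2 ∣ d → 1 ≤ c → Coprime d c →
    (toℚ (+ 2) ℚ.* s (+ d) c) ℚ.+ s (+ (2 * c)) d
      ≡ (frac (+ (d * d + c * c + 1)) (6 * c * d) - ½)
          - frac (+ 1) 4 ℚ.* toℚ (S₄ (+ c) (d ℕ./ 2))
lemma2 d c 1≤d (divides zero d≡0) _ _ = ⊥-elim (ℕP.<⇒≢ 1≤d (sym d≡0))
lemma2 d c _ 2∣d@(divides (suc m') d≡m*2) _ cop =
  subst₂ DedekindSumIdentity (sym d≡) (sym c≡) (dedekindSumIdentity (c ℕ./ 2) m' (subst₂ Coprime d≡ c≡ cop))
  where
  d≡ : d ≡ 2 * suc m'
  d≡ = trans d≡m*2 (ℕP.*-comm (suc m') 2)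
  c≡ : c ≡ suc (c ℕ./ 2 + c ℕ./ 2)
  c≡ = even-coprime⇒odd 2∣d cop
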